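{- Let $q\ge1$ and let $i_1,\dots,i_q$ be integers with $1\le i_1<\cdots<i_q\le 6$. Then there exists an $8$-dimensional integral polytope $\mathcal{P}$ such that the coefficients of $t^{i_1},\dots,t^{i_q}$ in $i(\mathcal{P},t)$ are negative, and all the remaining coefficients of $i(\mathcal{P},t)$ are positive.
   Context: An integral polytope is a convex polytope all of whose vertices have integer coordinates. For an integral polytope $\mathcal{P}\subseteq\mathbb{R}^N$ of dimension $d$, $i(\mathcal{P},t)=|t\mathcal{P}\cap\mathbb{Z}^N|$ ($t$ a positive integer) is a polynomial in $t$ of degree $d$, the Ehrhart polynomial. -}

module Defs where

open import Data.Nat using (ℕ; zero; suc)
open import Data.Integer as ℤ using (ℤ; +_)
open import Data.Rational as ℚ using (ℚ; 0ℚ; 1ℚ; _/_; _+_; _*_; _-_)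
open import Data.Fin using (Fin; zero; suc)
open import Data.Vec using (Vec; lookup)
open import Data.List using (List; length)
open import Data.List.Membership.Propositional using (_∈_)
open import Data.List.Relation.Unary.Unique.Propositional using (Unique)
open import Data.Product using (Σ; ∃; _×_)
open import Relation.Binary.PropositionalEquality using (_≡_)

ℤ→ℚ : ℤ → ℚ
ℤ→ℚ z = z / 1

ℕ→ℚ : ℕ → ℚ
ℕ→ℚ n = (+ n) / 1

_^ℚ_ : ℚ → ℕ → ℚ
x ^ℚ zero  = 1ℚ
x ^ℚ suc n = x * (x ^ℚ n)

sumℚ : (n : ℕ) → (Fin n → ℚ) → ℚ
sumℚ zero    f = 0ℚ
sumℚ (suc n) f = f zero + sumℚ n (λ j → f (suc j))

Point : ℕ → Set
Point N = Vec ℤ N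

-- An integral polytope in ℝ^N is given as the convex hull of a nonempty
-- finite list of integer points V_0,...,V_{m-1} (m = suc k).
-- x ∈ t·conv(V):  x = t · Σ_j λ_j V_j  with λ_j ≥ 0, Σ_j λ_j = 1, λ_j ∈ ℚ.
-- (For rational vertices and a rational point, rational coefficients suffice.)
InDilate : {N m : ℕ} → Vec (Point N) m → ℕ → Point N → Set
InDilate {N} {m} V t x =
  Σ (Fin m → ℚ) λ lam →
    ((j : Fin m) → 0ℚ ℚ.≤ lam j) ×
    (sumℚ m lam ≡ 1ℚ) ×
    ((i : Fin N) →
      ℤ→ℚ (lookup x i) ≡ ℕ→ℚ t * sumℚ m (λ j → lam j * ℤ→ℚ (lookup (lookup V j) i)))

LatticeCount : {N m : ℕ} → Vec (Point N) m → ℕ → ℕ → Set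
LatticeCount {N} V t n =
  Σ (List (Point N)) λ L →
    Unique L ×
    ((x : Point N) → (x ∈ L → InDilate V t x) × (InDilate V t x → x ∈ L)) ×
    (length L ≡ n)

diffVec : {N k : ℕ} → Vec (Point N) (suc k) → Fin k → Fin N → ℚ
diffVec V j i = ℤ→ℚ (lookup (lookup V (suc j)) i) - ℤ→ℚ (lookup (lookup V zero) i)

-- The (affine) dimension of conv(V) is d: the linear span over ℚ of the
-- difference vectors V_j - V_0 has dimension d, i.e. there are d of them
-- that are linearly independent and span all the others.
HasDimension : {N k : ℕ} → Vec (Point N) (suc k) → ℕ → Set
HasDimension {N} {k} V d =
  Σ (Fin d → Fin k) λ f →
    ((μ : Fin d → ℚ) →
      ((i : Fin N) → sumℚ d (λ l → μ l * diffVec V (f l) i) ≡ 0ℚ) →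
      (l : Fin d) → μ l ≡ 0ℚ) ×
    ((j : Fin k) → Σ (Fin d → ℚ) λ c →
      (i : Fin N) → diffVec V j i ≡ sumℚ d (λ l → c l * diffVec V (f l) i))

polyEval : (d : ℕ) → (Fin (suc d) → ℚ) → ℕ → ℚ
polyEval d c t = sumℚ (suc d) (λ k → c k * (ℕ→ℚ t ^ℚ Data.Fin.toℕ k))

data Increasing : List ℕ → Set where
  inc-[]  : Increasing Data.List.[]
  inc-one : ∀ a → Increasing (a Data.List.∷ Data.List.[])
  inc-two : ∀ {a b l} → a Data.Nat.< b → Increasing (b Data.List.∷ l) →
            Increasing (a Data.List.∷ b Data.List.∷ l)

-- The polytope is the Cayley polytope P = conv (B(a) × {0} ∪ B(b) × {1}) ⊂ ℝ⁸ of the boxes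
-- B(c) = [0, c₁] × ⋯ × [0, c₇], full-dimensional as soon as all aᵢ ≠ 0. Its t-th dilate meets the
-- hyperplane of height z in the box B((t − z) a + z b), so i(P, t) = Σ_{u + z = t} Πᵢ (1 + aᵢ u + bᵢ z).
-- Expanding the product in the basis (u choose α)(z choose β) and summing along the antidiagonal
-- with Chu–Vandermonde, Σ_{u + z = t} (u choose α)(z choose β) = (t + 1 choose α + β + 1), gives
-- i(P, t) explicitly as a polynomial of degree 8 in t. For each of the 2⁶ sign patterns on t¹, …, t⁶
-- an explicit pair (a, b) realising it is then checked by evaluation.

{-# OPTIONS --safe #-}
module Submission where

module RationalCasts where

  open import Defs
  open import Data.Nat as ℕ using (ℕ; zero; suc)
  open import Data.Integer as ℤ using (ℤ; +_)
  import Data.Integer.Properties as ℤP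
  open import Data.Rational as ℚ using (ℚ; mkℚ; 0ℚ; 1ℚ; _+_; _*_; _≤_; _<_; *≤*; *<*)
  import Data.Rational.Properties as ℚP
  import Data.Nat.Coprimality as Coprimality
  open import Data.Product using (Σ; _×_; _,_)
  open import Relation.Binary.PropositionalEquality

  ℤ→ℚ≡mkℚ : ∀ z → ℤ→ℚ z ≡ mkℚ z 0 (Coprimality.sym (Coprimality.1-coprimeTo ℤ.∣ z ∣))
  ℤ→ℚ≡mkℚ z = ℚP.↥p/↧p≡p (mkℚ z 0 _)

  ℤ→ℚ-+ : ∀ x y → ℤ→ℚ (x ℤ.+ y) ≡ ℤ→ℚ x + ℤ→ℚ y
  ℤ→ℚ-+ x y rewrite ℤ→ℚ≡mkℚ x | ℤ→ℚ≡mkℚ y =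
    cong (ℚ._/ 1) (sym (cong₂ ℤ._+_ (ℤP.*-identityʳ x) (ℤP.*-identityʳ y)))

  ℤ→ℚ-* : ∀ x y → ℤ→ℚ (x ℤ.* y) ≡ ℤ→ℚ x * ℤ→ℚ y
  ℤ→ℚ-* x y rewrite ℤ→ℚ≡mkℚ x | ℤ→ℚ≡mkℚ y = refl

  ℤ→ℚ-mono-≤ : ∀ {x y} → x ℤ.≤ y → ℤ→ℚ x ≤ ℤ→ℚ y
  ℤ→ℚ-mono-≤ {x} {y} x≤y rewrite ℤ→ℚ≡mkℚ x | ℤ→ℚ≡mkℚ y =
    *≤* (subst₂ ℤ._≤_ (sym (ℤP.*-identityʳ x)) (sym (ℤP.*-identityʳ y)) x≤y)

  ℤ→ℚ-cancel-≤ : ∀ {x y} → ℤ→ℚ x ≤ ℤ→ℚ y → x ℤ.≤ y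
  ℤ→ℚ-cancel-≤ {x} {y} x≤y rewrite ℤ→ℚ≡mkℚ x | ℤ→ℚ≡mkℚ y with x≤y
  ... | *≤* x*1≤y*1 = subst₂ ℤ._≤_ (ℤP.*-identityʳ x) (ℤP.*-identityʳ y) x*1≤y*1

  ℤ→ℚ-mono-< : ∀ {x y} → x ℤ.< y → ℤ→ℚ x < ℤ→ℚ y
  ℤ→ℚ-mono-< {x} {y} x<y rewrite ℤ→ℚ≡mkℚ x | ℤ→ℚ≡mkℚ y =
    *<* (subst₂ ℤ._<_ (sym (ℤP.*-identityʳ x)) (sym (ℤP.*-identityʳ y)) x<y)

  ℕ→ℚ-+ : ∀ m n → ℕ→ℚ (m ℕ.+ n) ≡ ℕ→ℚ m + ℕ→ℚ n
  ℕ→ℚ-+ m n = trans (cong ℤ→ℚ (ℤP.pos-+ m n)) (ℤ→ℚ-+ (+ m) (+ n))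

  ℕ→ℚ-* : ∀ m n → ℕ→ℚ (m ℕ.* n) ≡ ℕ→ℚ m * ℕ→ℚ n
  ℕ→ℚ-* m n = trans (cong ℤ→ℚ (sym (ℤP.+◃n≡+n (m ℕ.* n)))) (ℤ→ℚ-* (+ m) (+ n))

  ℕ→ℚ-mono-≤ : ∀ {m n} → m ℕ.≤ n → ℕ→ℚ m ≤ ℕ→ℚ n
  ℕ→ℚ-mono-≤ {m} {n} m≤n = ℤ→ℚ-mono-≤ {+ m} {+ n} (ℤ.+≤+ m≤n)

  ℕ→ℚ-nonNeg : ∀ n → 0ℚ ≤ ℕ→ℚ n
  ℕ→ℚ-nonNeg n = ℕ→ℚ-mono-≤ {0} {n} ℕ.z≤n

  ℕ→ℚ-suc-pos : ∀ n → 0ℚ < ℕ→ℚ (suc n)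
  ℕ→ℚ-suc-pos n = ℤ→ℚ-mono-< {+ 0} {+ suc n} (ℤ.+<+ (ℕ.s≤s ℕ.z≤n))

  ℕ→ℚ-≢0 : ∀ {n} → n ≢ 0 → ℕ→ℚ n ≢ 0ℚ
  ℕ→ℚ-≢0 {zero}  n≢0 = λ _ → n≢0 refl
  ℕ→ℚ-≢0 {suc n} _   = λ n≡0 → ℚP.<⇒≢ (ℕ→ℚ-suc-pos n) (sym n≡0)

  ℕ→ℚ-suc-nonZero : ∀ n → ℚ.NonZero (ℕ→ℚ (suc n))
  ℕ→ℚ-suc-nonZero n = ℚ.>-nonZero (ℕ→ℚ-suc-pos n)

  *-nonNeg : ∀ {p q} → 0ℚ ≤ p → 0ℚ ≤ q → 0ℚ ≤ p * q
  *-nonNeg {p} {q} 0≤p 0≤q =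
    ℚP.nonNegative⁻¹ (p * q) {{ℚP.nonNeg*nonNeg⇒nonNeg p {{ℚ.nonNegative 0≤p}} q {{ℚ.nonNegative 0≤q}}}}

  recip-suc : ℕ → ℚ
  recip-suc n = (ℚ.1/ ℕ→ℚ (suc n)) {{ℕ→ℚ-suc-nonZero n}}

  recip-suc-inverseˡ : ∀ n → recip-suc n * ℕ→ℚ (suc n) ≡ 1ℚ
  recip-suc-inverseˡ n = ℚP.*-inverseˡ (ℕ→ℚ (suc n)) {{ℕ→ℚ-suc-nonZero n}}

  recip-suc-inverseʳ : ∀ n → ℕ→ℚ (suc n) * recip-suc n ≡ 1ℚ
  recip-suc-inverseʳ n = ℚP.*-inverseʳ (ℕ→ℚ (suc n)) {{ℕ→ℚ-suc-nonZero n}}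

  recip-suc-nonNeg : ∀ n → 0ℚ ≤ recip-suc n
  recip-suc-nonNeg n = ℚP.nonNegative⁻¹ (recip-suc n)
    {{ℚP.pos⇒nonNeg (recip-suc n) {{ℚP.1/pos⇒pos (ℕ→ℚ (suc n)) {{ℚ.positive (ℕ→ℚ-suc-pos n)}}}}}}

  fraction : ∀ {y L} → y ℕ.≤ L → Σ ℚ λ θ → 0ℚ ≤ θ × θ ≤ 1ℚ × θ * ℕ→ℚ L ≡ ℕ→ℚ y
  fraction {L = zero} ℕ.z≤n = 0ℚ , ℚP.≤-refl , ℕ→ℚ-nonNeg 1 , refl
  fraction {y} {suc L} y≤L = ℕ→ℚ y * recip-suc L , 0≤θ , θ≤1 , θL≡y
    where
    open ≡-Reasoning
    θL≡y : ℕ→ℚ y * recip-suc L * ℕ→ℚ (suc L) ≡ ℕ→ℚ y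
    θL≡y = begin
      ℕ→ℚ y * recip-suc L * ℕ→ℚ (suc L)    ≡⟨ ℚP.*-assoc (ℕ→ℚ y) _ _ ⟩
      ℕ→ℚ y * (recip-suc L * ℕ→ℚ (suc L))  ≡⟨ cong (ℕ→ℚ y *_) (recip-suc-inverseˡ L) ⟩
      ℕ→ℚ y * 1ℚ                           ≡⟨ ℚP.*-identityʳ (ℕ→ℚ y) ⟩
      ℕ→ℚ y                                ∎
    0≤θ = *-nonNeg (ℕ→ℚ-nonNeg y) (recip-suc-nonNeg L)
    θ≤1 = ℚP.≤-trans
      (ℚP.*-monoʳ-≤-nonNeg (recip-suc L) {{ℚ.nonNegative (recip-suc-nonNeg L)}} (ℕ→ℚ-mono-≤ y≤L))
      (ℚP.≤-reflexive (recip-suc-inverseʳ L))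

  ℤ→ℚ-in-range : ∀ w L → 0ℚ ≤ ℤ→ℚ w → ℤ→ℚ w ≤ ℕ→ℚ L →
                 Σ ℕ λ y → w ≡ + y × y ℕ.≤ L
  ℤ→ℚ-in-range w L 0≤w w≤L = ℤ.∣ w ∣ , sym w≡∣w∣ ,
    ℤP.drop‿+≤+ (subst (ℤ._≤ + L) (sym w≡∣w∣) (ℤ→ℚ-cancel-≤ {w} {+ L} w≤L))
    where w≡∣w∣ = ℤP.0≤i⇒+∣i∣≡i (ℤ→ℚ-cancel-≤ {+ 0} {w} 0≤w)

module FiniteSums where

  open import Defs
  open import Data.Nat as ℕ using (ℕ; zero; suc)
  open import Data.Rational using (ℚ; 0ℚ; _+_; _*_; _≤_)
  import Data.Rational.Properties as ℚP
  open import Data.Rational.Solver using (module +-*-Solver)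
  open import Data.Fin using (Fin; zero; suc; _↑ˡ_; _↑ʳ_)
  open import Relation.Binary.PropositionalEquality
  open +-*-Solver

  sum-cong : ∀ n {f g : Fin n → ℚ} → (∀ i → f i ≡ g i) → sumℚ n f ≡ sumℚ n g
  sum-cong zero    f≗g = refl
  sum-cong (suc n) f≗g = cong₂ _+_ (f≗g zero) (sum-cong n (λ i → f≗g (suc i)))

  sum-zero : ∀ n → sumℚ n (λ _ → 0ℚ) ≡ 0ℚ
  sum-zero zero    = refl
  sum-zero (suc n) = cong (0ℚ +_) (sum-zero n)

  sum-+ : ∀ n (f g : Fin n → ℚ) → sumℚ n (λ i → f i + g i) ≡ sumℚ n f + sumℚ n g
  sum-+ zero    f g = refl
  sum-+ (suc n) f g = begin
    f zero + g zero + sumℚ n (λ i → f (suc i) + g (suc i))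
      ≡⟨ cong (f zero + g zero +_) (sum-+ n (λ i → f (suc i)) (λ i → g (suc i))) ⟩
    f zero + g zero + (F + G)
      ≡⟨ solve 4 (λ a b c d → a :+ b :+ (c :+ d) := a :+ c :+ (b :+ d)) refl (f zero) (g zero) F G ⟩
    f zero + F + (g zero + G) ∎
    where
    open ≡-Reasoning
    F = sumℚ n (λ i → f (suc i))
    G = sumℚ n (λ i → g (suc i))

  sum-*ˡ : ∀ n c (f : Fin n → ℚ) → sumℚ n (λ i → c * f i) ≡ c * sumℚ n f
  sum-*ˡ zero    c f = sym (ℚP.*-zeroʳ c)
  sum-*ˡ (suc n) c f = trans (cong (c * f zero +_) (sum-*ˡ n c (λ i → f (suc i))))
                             (sym (ℚP.*-distribˡ-+ c (f zero) _))

  sum-splitAt : ∀ m n (f : Fin (m ℕ.+ n) → ℚ) →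
                sumℚ (m ℕ.+ n) f ≡ sumℚ m (λ i → f (i ↑ˡ n)) + sumℚ n (λ j → f (m ↑ʳ j))
  sum-splitAt zero    n f = sym (ℚP.+-identityˡ _)
  sum-splitAt (suc m) n f = trans (cong (f zero +_) (sum-splitAt m n (λ i → f (suc i))))
                                  (sym (ℚP.+-assoc (f zero) _ _))

  sum-mono-≤ : ∀ n {f g : Fin n → ℚ} → (∀ i → f i ≤ g i) → sumℚ n f ≤ sumℚ n g
  sum-mono-≤ zero    f≤g = ℚP.≤-refl
  sum-mono-≤ (suc n) f≤g = ℚP.+-mono-≤ (f≤g zero) (sum-mono-≤ n (λ i → f≤g (suc i)))

  sum-nonNeg : ∀ n {f : Fin n → ℚ} → (∀ i → 0ℚ ≤ f i) → 0ℚ ≤ sumℚ n f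
  sum-nonNeg n {f} 0≤f = subst (_≤ sumℚ n f) (sum-zero n) (sum-mono-≤ n 0≤f)

module Lifting where

  open import Defs
  open RationalCasts
  open FiniteSums
  open import Data.Nat as ℕ using (ℕ; zero; suc)
  open import Data.Integer using (+_)
  open import Data.Rational as ℚ using (ℚ; 0ℚ; 1ℚ; _+_; _*_; _-_; _≤_)
  import Data.Rational.Properties as ℚP
  open import Data.Rational.Solver using (module +-*-Solver)
  open import Data.Fin using (Fin; zero; suc; _↑ˡ_; _↑ʳ_; splitAt)
  open import Data.Vec using (_∷_; lookup; tabulate)
  import Data.Vec.Properties as Vecₚ
  open import Data.Vec.Functional using (Vector; _++_)
  import Data.Vec.Functional.Properties as Vectorₚ
  open import Data.Sum using (inj₁; inj₂)
  open import Data.Product using (Σ; _×_; _,_)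
  open import Function using (_∘_; _⇔_; mk⇔)
  open import Relation.Binary.PropositionalEquality
  open +-*-Solver

  private variable
    m n N : ℕ

  all-++ : {A : Set} {P : A → Set} (f : Vector A m) (g : Vector A n) →
           (∀ i → P (f i)) → (∀ j → P (g j)) → ∀ k → P ((f ++ g) k)
  all-++ {m = m} f g Pf Pg k with splitAt m k
  ... | inj₁ i = Pf i
  ... | inj₂ j = Pg j

  IsWeighting : Vector ℚ m → Set
  IsWeighting {m} μ = (∀ j → 0ℚ ≤ μ j) × sumℚ m μ ≡ 1ℚ

  dilatedMean : ℕ → Vector ℚ m → Vector ℚ m → ℚ
  dilatedMean {m} t μ g = ℕ→ℚ t * sumℚ m (λ j → μ j * g j)

  coord : Fin N → Point N → ℚ
  coord i x = ℤ→ℚ (lookup x i)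

  Represents : Vector (Point N) m → ℕ → Vector ℚ m → Point N → Set
  Represents v t μ x = ∀ i → coord i x ≡ dilatedMean t μ (coord i ∘ v)

  InDilateᶠ : Vector (Point N) m → ℕ → Point N → Set
  InDilateᶠ {m = m} v t x = Σ (Vector ℚ m) λ μ → IsWeighting μ × Represents v t μ x

  InDilate-tabulate : ∀ (v : Vector (Point N) m) t x → InDilate (tabulate v) t x ⇔ InDilateᶠ v t x
  InDilate-tabulate {m = m} v t x = mk⇔
    (λ (μ , μ≥0 , Σμ≡1 , rep) → μ , (μ≥0 , Σμ≡1) , λ i → trans (rep i) (tabulated μ i))
    (λ (μ , (μ≥0 , Σμ≡1) , rep) → μ , μ≥0 , Σμ≡1 , λ i → trans (rep i) (sym (tabulated μ i)))
    where
    tabulated : ∀ μ i → dilatedMean t μ (coord i ∘ lookup (tabulate v)) ≡ dilatedMean t μ (coord i ∘ v)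
    tabulated μ i =
      cong (ℕ→ℚ t *_) (sum-cong m (λ j → cong (λ p → μ j * coord i p) (Vecₚ.lookup∘tabulate v j)))

  dilatedMean-affine : ∀ t (μ : Vector ℚ m) {g h : Vector ℚ m} A B → sumℚ m μ ≡ 1ℚ →
                       (∀ j → g j ≡ A + B * h j) → dilatedMean t μ g ≡ A * ℕ→ℚ t + B * dilatedMean t μ h
  dilatedMean-affine {m} t μ {g} {h} A B Σμ≡1 g≡A+Bh = begin
    T * sumℚ m (λ j → μ j * g j)
      ≡⟨ cong (T *_) (sum-cong m (λ j → trans (cong (μ j *_) (g≡A+Bh j))
           (solve 4 (λ μ A B h → μ :* (A :+ B :* h) := A :* μ :+ B :* (μ :* h)) refl (μ j) A B (h j)))) ⟩
    T * sumℚ m (λ j → A * μ j + B * (μ j * h j))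
      ≡⟨ cong (T *_) (sum-+ m (λ j → A * μ j) (λ j → B * (μ j * h j))) ⟩
    T * (sumℚ m (λ j → A * μ j) + sumℚ m (λ j → B * (μ j * h j)))
      ≡⟨ cong (T *_) (cong₂ _+_ (trans (sum-*ˡ m A μ) (cong (A *_) Σμ≡1)) (sum-*ˡ m B (λ j → μ j * h j))) ⟩
    T * (A * 1ℚ + B * H)
      ≡⟨ solve 4 (λ T A B H → T :* (A :* con 1ℚ :+ B :* H) := A :* T :+ B :* (T :* H)) refl T A B H ⟩
    A * T + B * (T * H) ∎
    where
    open ≡-Reasoning
    T = ℕ→ℚ t
    H = sumℚ m (λ j → μ j * h j)

  dilatedMean-const : ∀ t (μ : Vector ℚ m) c → sumℚ m μ ≡ 1ℚ →
                      dilatedMean t μ (λ _ → c) ≡ c * ℕ→ℚ t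
  dilatedMean-const {m} t μ c Σμ≡1 = begin
    T * sumℚ m (λ j → μ j * c)   ≡⟨ cong (T *_) (sum-cong m (λ j → ℚP.*-comm (μ j) c)) ⟩
    T * sumℚ m (λ j → c * μ j)   ≡⟨ cong (T *_) (trans (sum-*ˡ m c μ) (cong (c *_) Σμ≡1)) ⟩
    T * (c * 1ℚ)                 ≡⟨ solve 2 (λ T c → T :* (c :* con 1ℚ) := c :* T) refl T c ⟩
    c * T                        ∎
    where
    open ≡-Reasoning
    T = ℕ→ℚ t

  -- Vertices (0, vⱼ) and (ℓⱼ, vⱼ): a prism over conv v whose top follows the heights ℓ.
  lift : Vector ℕ m → Vector (Point N) m → Vector (Point (suc N)) (m ℕ.+ m)
  lift ℓ v = (λ j → + 0 ∷ v j) ++ (λ j → + ℓ j ∷ v j)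

  module _ (ℓ : Vector ℕ m) (v : Vector (Point N) m) (ν : Vector ℚ (m ℕ.+ m)) where

    private
      sum-lift : ∀ (F : Point (suc N) → ℚ) →
        sumℚ (m ℕ.+ m) (λ k → ν k * F (lift ℓ v k)) ≡
        sumℚ m (λ j → ν (j ↑ˡ m) * F (+ 0 ∷ v j)) + sumℚ m (λ j → ν (m ↑ʳ j) * F (+ ℓ j ∷ v j))
      sum-lift F = trans (sum-splitAt m m _) (cong₂ _+_
        (sum-cong m (λ j → cong (λ p → ν (j ↑ˡ m) * F p) (Vectorₚ.lookup-++ˡ bottom top j)))
        (sum-cong m (λ j → cong (λ p → ν (m ↑ʳ j) * F p) (Vectorₚ.lookup-++ʳ bottom top j))))
        where
        bottom top : Vector (Point (suc N)) m
        bottom j = + 0 ∷ v j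
        top    j = + ℓ j ∷ v j

    sum-lift-coord-zero : sumℚ (m ℕ.+ m) (λ k → ν k * coord zero (lift ℓ v k)) ≡
                          sumℚ m (λ j → ν (m ↑ʳ j) * ℕ→ℚ (ℓ j))
    sum-lift-coord-zero = begin
      sumℚ (m ℕ.+ m) (λ k → ν k * coord zero (lift ℓ v k))
        ≡⟨ sum-lift (coord zero) ⟩
      sumℚ m (λ j → ν (j ↑ˡ m) * 0ℚ) + R
        ≡⟨ cong (_+ R) (trans (sum-cong m (λ j → ℚP.*-zeroʳ (ν (j ↑ˡ m)))) (sum-zero m)) ⟩
      0ℚ + R
        ≡⟨ ℚP.+-identityˡ R ⟩
      R ∎
      where
      open ≡-Reasoning
      R = sumℚ m (λ j → ν (m ↑ʳ j) * ℕ→ℚ (ℓ j))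

    sum-lift-coord-suc : ∀ i → sumℚ (m ℕ.+ m) (λ k → ν k * coord (suc i) (lift ℓ v k)) ≡
                               sumℚ m (λ j → (ν (j ↑ˡ m) + ν (m ↑ʳ j)) * coord i (v j))
    sum-lift-coord-suc i = trans (sum-lift (coord (suc i))) (trans (sym (sum-+ m _ _))
      (sum-cong m (λ j → sym (ℚP.*-distribʳ-+ (coord i (v j)) (ν (j ↑ˡ m)) (ν (m ↑ʳ j))))))

  lift⁺ : ∀ (ℓ : Vector ℕ m) (v : Vector (Point N) m) t {μ x θ y} →
          IsWeighting μ → Represents v t μ x → 0ℚ ≤ θ → θ ≤ 1ℚ →
          ℤ→ℚ y ≡ θ * dilatedMean t μ (ℕ→ℚ ∘ ℓ) → InDilateᶠ (lift ℓ v) t (y ∷ x)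
  lift⁺ {m} ℓ v t {μ} {x} {θ} {y} (μ≥0 , Σμ≡1) rep 0≤θ θ≤1 y≡θL = ν , (ν≥0 , Σν≡1) , repν
    where
    open ≡-Reasoning
    T = ℕ→ℚ t
    ν : Vector ℚ (m ℕ.+ m)
    ν = (λ j → (1ℚ - θ) * μ j) ++ (λ j → θ * μ j)
    νˡ : ∀ j → ν (j ↑ˡ m) ≡ (1ℚ - θ) * μ j
    νˡ = Vectorₚ.lookup-++ˡ (λ j → (1ℚ - θ) * μ j) (λ j → θ * μ j)
    νʳ : ∀ j → ν (m ↑ʳ j) ≡ θ * μ j
    νʳ = Vectorₚ.lookup-++ʳ (λ j → (1ℚ - θ) * μ j) (λ j → θ * μ j)
    0≤1-θ : 0ℚ ≤ 1ℚ - θ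
    0≤1-θ = ℚP.+-monoʳ-≤ 1ℚ (ℚP.neg-antimono-≤ θ≤1)
    ν≥0 = all-++ {P = 0ℚ ≤_} _ _ (λ j → *-nonNeg 0≤1-θ (μ≥0 j)) (λ j → *-nonNeg 0≤θ (μ≥0 j))
    Σν≡1 = begin
      sumℚ (m ℕ.+ m) ν
        ≡⟨ sum-splitAt m m ν ⟩
      sumℚ m (λ j → ν (j ↑ˡ m)) + sumℚ m (λ j → ν (m ↑ʳ j))
        ≡⟨ cong₂ _+_ (trans (sum-cong m νˡ) (sum-*ˡ m (1ℚ - θ) μ))
                     (trans (sum-cong m νʳ) (sum-*ˡ m θ μ)) ⟩
      (1ℚ - θ) * sumℚ m μ + θ * sumℚ m μ
        ≡⟨ cong (λ s → (1ℚ - θ) * s + θ * s) Σμ≡1 ⟩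
      (1ℚ - θ) * 1ℚ + θ * 1ℚ
        ≡⟨ solve 1 (λ θ → (con 1ℚ :- θ) :* con 1ℚ :+ θ :* con 1ℚ := con 1ℚ) refl θ ⟩
      1ℚ ∎
    repν : Represents (lift ℓ v) t ν (y ∷ x)
    repν zero = begin
      ℤ→ℚ y
        ≡⟨ y≡θL ⟩
      θ * (T * sumℚ m (λ j → μ j * ℕ→ℚ (ℓ j)))
        ≡⟨ solve 3 (λ θ T S → θ :* (T :* S) := T :* (θ :* S)) refl θ T _ ⟩
      T * (θ * sumℚ m (λ j → μ j * ℕ→ℚ (ℓ j)))
        ≡⟨ cong (T *_) (sym (sum-*ˡ m θ _)) ⟩
      T * sumℚ m (λ j → θ * (μ j * ℕ→ℚ (ℓ j)))
        ≡⟨ cong (T *_) (sum-cong m (λ j →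
             trans (sym (ℚP.*-assoc θ (μ j) _)) (cong (_* ℕ→ℚ (ℓ j)) (sym (νʳ j))))) ⟩
      T * sumℚ m (λ j → ν (m ↑ʳ j) * ℕ→ℚ (ℓ j))
        ≡⟨ cong (T *_) (sym (sum-lift-coord-zero ℓ v ν)) ⟩
      dilatedMean t ν (coord zero ∘ lift ℓ v) ∎
    repν (suc i) = begin
      coord i x
        ≡⟨ rep i ⟩
      T * sumℚ m (λ j → μ j * coord i (v j))
        ≡⟨ cong (T *_) (sum-cong m (λ j → cong (_* coord i (v j)) (split j))) ⟩
      T * sumℚ m (λ j → (ν (j ↑ˡ m) + ν (m ↑ʳ j)) * coord i (v j))
        ≡⟨ cong (T *_) (sym (sum-lift-coord-suc ℓ v ν i)) ⟩
      dilatedMean t ν (coord (suc i) ∘ lift ℓ v) ∎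
      where
      split : ∀ j → μ j ≡ ν (j ↑ˡ m) + ν (m ↑ʳ j)
      split j = trans (solve 2 (λ θ μ → μ := (con 1ℚ :- θ) :* μ :+ θ :* μ) refl θ (μ j))
                      (sym (cong₂ _+_ (νˡ j) (νʳ j)))

  lift⁻ : ∀ (ℓ : Vector ℕ m) (v : Vector (Point N) m) t {x y} → InDilateᶠ (lift ℓ v) t (y ∷ x) →
          Σ (Vector ℚ m) λ μ → IsWeighting μ × Represents v t μ x ×
            0ℚ ≤ ℤ→ℚ y × ℤ→ℚ y ≤ dilatedMean t μ (ℕ→ℚ ∘ ℓ)
  lift⁻ {m} ℓ v t {x} {y} (ν , (ν≥0 , Σν≡1) , repν) = μ , (μ≥0 , Σμ≡1) , rep , 0≤y , y≤L
    where
    μ : Vector ℚ m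
    μ j = ν (j ↑ˡ m) + ν (m ↑ʳ j)
    μ≥0 : ∀ j → 0ℚ ≤ μ j
    μ≥0 j = ℚP.+-mono-≤ (ν≥0 (j ↑ˡ m)) (ν≥0 (m ↑ʳ j))
    νʳ≤μ : ∀ j → ν (m ↑ʳ j) ≤ μ j
    νʳ≤μ j =
      subst (_≤ μ j) (ℚP.+-identityˡ (ν (m ↑ʳ j))) (ℚP.+-monoˡ-≤ (ν (m ↑ʳ j)) (ν≥0 (j ↑ˡ m)))
    Σμ≡1 = trans (sum-+ m _ _) (trans (sym (sum-splitAt m m ν)) Σν≡1)
    rep : Represents v t μ x
    rep i = trans (repν (suc i)) (cong (ℕ→ℚ t *_) (sum-lift-coord-suc ℓ v ν i))
    y≡ : ℤ→ℚ y ≡ ℕ→ℚ t * sumℚ m (λ j → ν (m ↑ʳ j) * ℕ→ℚ (ℓ j))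
    y≡ = trans (repν zero) (cong (ℕ→ℚ t *_) (sum-lift-coord-zero ℓ v ν))
    0≤y = subst (0ℚ ≤_) (sym y≡)
      (*-nonNeg (ℕ→ℚ-nonNeg t) (sum-nonNeg m (λ j → *-nonNeg (ν≥0 (m ↑ʳ j)) (ℕ→ℚ-nonNeg (ℓ j)))))
    y≤L = subst (_≤ dilatedMean t μ (ℕ→ℚ ∘ ℓ)) (sym y≡)
      (ℚP.*-monoˡ-≤-nonNeg (ℕ→ℚ t) {{ℚ.nonNegative (ℕ→ℚ-nonNeg t)}} (sum-mono-≤ m (λ j →
        ℚP.*-monoʳ-≤-nonNeg (ℕ→ℚ (ℓ j)) {{ℚ.nonNegative (ℕ→ℚ-nonNeg (ℓ j))}} (νʳ≤μ j))))

module CayleyPolytope where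

  open import Defs
  open RationalCasts
  open Lifting
  open import Data.Bool using (Bool; true; false; if_then_else_)
  open import Data.Nat as ℕ using (ℕ; zero; suc)
  import Data.Nat.Properties as ℕP
  open import Data.Integer using (+_)
  open import Data.Rational using (ℚ; 0ℚ; 1ℚ; _+_; _*_; _-_; _≤_)
  import Data.Rational.Properties as ℚP
  open import Data.Rational.Solver using (module +-*-Solver)
  open import Data.Fin using (zero; suc; fromℕ; splitAt; _↑ˡ_; _↑ʳ_)
  open import Data.Vec using (Vec; []; _∷_; lookup)
  open import Data.Vec.Functional using (Vector; _++_) renaming ([] to []ᵛ; _∷_ to _∷ᵛ_)
  open import Data.Sum using (inj₁; inj₂)
  import Data.Vec.Functional.Properties as Vectorₚ
  open import Data.Product using (Σ; _×_; _,_)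
  open import Function using (_∘_; _⇔_; mk⇔)
  open import Relation.Binary.PropositionalEquality
  open +-*-Solver

  -- The Cayley polytope has 2ⁿ⁺¹ = suc (lastVertex n) vertices, a visible successor as the vertex
  -- list in the statement requires.
  lastVertex : ℕ → ℕ
  lastVertex zero    = 1
  lastVertex (suc n) = lastVertex n ℕ.+ suc (lastVertex n)

  onTop : ∀ n → Vector Bool (suc (lastVertex n))
  onTop zero    = false ∷ᵛ true ∷ᵛ []ᵛ
  onTop (suc n) = onTop n ++ onTop n

  point : Vector (Point 0) 1
  point _ = []

  heights : ∀ n → ℕ → ℕ → Vector ℕ (suc (lastVertex n))
  heights n a b j = if onTop n j then b else a

  -- The Cayley polytope conv (B(a) × {0} ∪ B(b) × {1}) of the boxes B(c) = Πᵢ [0, cᵢ], with the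
  -- height last: each box coordinate is a lift over the polytope of the remaining coordinates.
  cayley : ∀ n → Vec ℕ n → Vec ℕ n → Vector (Point (suc n)) (suc (lastVertex n))
  cayley zero    []       []       = lift (λ _ → 1) point
  cayley (suc n) (a ∷ as) (b ∷ bs) = lift (heights n a b) (cayley n as bs)

  cayley-bottom : ∀ n a as b bs j →
                  cayley (suc n) (a ∷ as) (b ∷ bs) (j ↑ˡ suc (lastVertex n)) ≡ + 0 ∷ cayley n as bs j
  cayley-bottom n a as b bs =
    Vectorₚ.lookup-++ˡ (λ j → + 0 ∷ cayley n as bs j) (λ j → + heights n a b j ∷ cayley n as bs j)

  cayley-top : ∀ n a as b bs j →
               cayley (suc n) (a ∷ as) (b ∷ bs) (suc (lastVertex n) ↑ʳ j) ≡ + heights n a b j ∷ cayley n as bs j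
  cayley-top n a as b bs =
    Vectorₚ.lookup-++ʳ (λ j → + 0 ∷ cayley n as bs j) (λ j → + heights n a b j ∷ cayley n as bs j)

  cayley-height : ∀ n as bs j → lookup (cayley n as bs j) (fromℕ n) ≡ (if onTop n j then + 1 else + 0)
  cayley-height zero [] [] zero       = refl
  cayley-height zero [] [] (suc zero) = refl
  cayley-height (suc n) (a ∷ as) (b ∷ bs) j with splitAt (suc (lastVertex n)) j
  ... | inj₁ i = cayley-height n as bs i
  ... | inj₂ i = cayley-height n as bs i

  InSlice : ∀ n → Vec ℕ n → Vec ℕ n → ℕ → ℕ → Point (suc n) → Set
  InSlice zero    []       []       u z (w ∷ []) = w ≡ + z
  InSlice (suc n) (a ∷ as) (b ∷ bs) u z (w ∷ x) =
    (Σ ℕ λ y → w ≡ + y × y ℕ.≤ a ℕ.* u ℕ.+ b ℕ.* z) × InSlice n as bs u z x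

  CayleyLatticePoint : ∀ n → Vec ℕ n → Vec ℕ n → ℕ → Point (suc n) → Set
  CayleyLatticePoint n as bs t x = Σ ℕ λ u → Σ ℕ λ z → u ℕ.+ z ≡ t × InSlice n as bs u z x

  InSlice-height : ∀ n as bs {u z} x → InSlice n as bs u z x → lookup x (fromℕ n) ≡ + z
  InSlice-height zero    []       []       (w ∷ []) w≡z           = w≡z
  InSlice-height (suc n) (a ∷ as) (b ∷ bs) (w ∷ x)  (_ , slice) = InSlice-height n as bs x slice

  -- The heights a, b of the new coordinate are affine in the last coordinate, so their
  -- mean over a representation of x is determined by x alone.
  mean-heights : ∀ n as bs a b t μ x u z → IsWeighting μ → Represents (cayley n as bs) t μ x →
                 InSlice n as bs u z x → u ℕ.+ z ≡ t →
                 dilatedMean t μ (ℕ→ℚ ∘ heights n a b) ≡ ℕ→ℚ (a ℕ.* u ℕ.+ b ℕ.* z)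
  mean-heights n as bs a b t μ x u z (_ , Σμ≡1) rep slice u+z≡t = begin
    dilatedMean t μ (ℕ→ℚ ∘ heights n a b)
      ≡⟨ dilatedMean-affine t μ A (B - A) Σμ≡1 affine ⟩
    A * ℕ→ℚ t + (B - A) * dilatedMean t μ (coord (fromℕ n) ∘ cayley n as bs)
      ≡⟨ cong₂ (λ T Z → A * T + (B - A) * Z)
           (trans (cong ℕ→ℚ (sym u+z≡t)) (ℕ→ℚ-+ u z))
           (trans (sym (rep (fromℕ n))) (cong ℤ→ℚ (InSlice-height n as bs x slice))) ⟩
    A * (ℕ→ℚ u + ℕ→ℚ z) + (B - A) * ℕ→ℚ z
      ≡⟨ solve 4 (λ A B U Z → A :* (U :+ Z) :+ (B :- A) :* Z := A :* U :+ B :* Z)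
                 refl A B (ℕ→ℚ u) (ℕ→ℚ z) ⟩
    A * ℕ→ℚ u + B * ℕ→ℚ z
      ≡⟨ sym (trans (ℕ→ℚ-+ (a ℕ.* u) (b ℕ.* z)) (cong₂ _+_ (ℕ→ℚ-* a u) (ℕ→ℚ-* b z))) ⟩
    ℕ→ℚ (a ℕ.* u ℕ.+ b ℕ.* z) ∎
    where
    open ≡-Reasoning
    A = ℕ→ℚ a
    B = ℕ→ℚ b
    affine : ∀ j → ℕ→ℚ (heights n a b j) ≡ A + (B - A) * coord (fromℕ n) (cayley n as bs j)
    affine j rewrite cayley-height n as bs j with onTop n j
    ... | true  = solve 2 (λ A B → B := A :+ (B :- A) :* con 1ℚ) refl A B
    ... | false = solve 2 (λ A B → A := A :+ (B :- A) :* con 0ℚ) refl A B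

  private
    unitWeight : IsWeighting {1} (λ _ → 1ℚ)
    unitWeight = (λ _ → ℕ→ℚ-nonNeg 1) , refl

    mean-one : ∀ t (μ : Vector ℚ 1) → sumℚ 1 μ ≡ 1ℚ → dilatedMean t μ (λ _ → ℕ→ℚ 1) ≡ ℕ→ℚ t
    mean-one t μ Σμ≡1 = trans (dilatedMean-const t μ (ℕ→ℚ 1) Σμ≡1) (ℚP.*-identityˡ (ℕ→ℚ t))

  InDilate-cayley⁺ : ∀ n as bs t x → CayleyLatticePoint n as bs t x → InDilateᶠ (cayley n as bs) t x
  InDilate-cayley⁺ zero [] [] t (w ∷ []) (u , z , u+z≡t , w≡z) =
    let θ , 0≤θ , θ≤1 , θt≡z = fraction (subst (z ℕ.≤_) u+z≡t (ℕP.m≤n+m z u))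
    in lift⁺ (λ _ → 1) point t unitWeight (λ ()) 0≤θ θ≤1
         (trans (cong ℤ→ℚ w≡z) (sym (trans (cong (θ *_) (mean-one t (λ _ → 1ℚ) refl)) θt≡z)))
  InDilate-cayley⁺ (suc n) (a ∷ as) (b ∷ bs) t (w ∷ x) (u , z , u+z≡t , (y , w≡y , y≤L) , slice) =
    let μ , weighting , rep = InDilate-cayley⁺ n as bs t x (u , z , u+z≡t , slice)
        θ , 0≤θ , θ≤1 , θL≡y = fraction y≤L
        M≡L = mean-heights n as bs a b t μ x u z weighting rep slice u+z≡t
    in lift⁺ (heights n a b) (cayley n as bs) t weighting rep 0≤θ θ≤1
         (trans (cong ℤ→ℚ w≡y) (sym (trans (cong (θ *_) M≡L) θL≡y)))

  InDilate-cayley⁻ : ∀ n as bs t x → InDilateᶠ (cayley n as bs) t x → CayleyLatticePoint n as bs t x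
  InDilate-cayley⁻ zero [] [] t (w ∷ []) p =
    let μ , (_ , Σμ≡1) , _ , 0≤w , w≤t = lift⁻ (λ _ → 1) point t p
        z , w≡z , z≤t = ℤ→ℚ-in-range w t 0≤w (subst (ℤ→ℚ w ≤_) (mean-one t μ Σμ≡1) w≤t)
    in t ℕ.∸ z , z , ℕP.m∸n+n≡m z≤t , w≡z
  InDilate-cayley⁻ (suc n) (a ∷ as) (b ∷ bs) t (w ∷ x) p =
    let μ , weighting , rep , 0≤w , w≤M = lift⁻ (heights n a b) (cayley n as bs) t p
        u , z , u+z≡t , slice = InDilate-cayley⁻ n as bs t x (μ , weighting , rep)
        M≡L = mean-heights n as bs a b t μ x u z weighting rep slice u+z≡t
    in u , z , u+z≡t , ℤ→ℚ-in-range w (a ℕ.* u ℕ.+ b ℕ.* z) 0≤w (subst (ℤ→ℚ w ≤_) M≡L w≤M) , slice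

  InDilate-cayley : ∀ n as bs t x → InDilateᶠ (cayley n as bs) t x ⇔ CayleyLatticePoint n as bs t x
  InDilate-cayley n as bs t x = mk⇔ (InDilate-cayley⁻ n as bs t x) (InDilate-cayley⁺ n as bs t x)

module CayleyDimension where

  open import Defs
  open RationalCasts
  open FiniteSums
  open CayleyPolytope
  open import Data.Bool using (true; false; if_then_else_)
  open import Data.Nat using (ℕ; zero; suc)
  open import Data.Integer using (+_)
  open import Data.Rational as ℚ using (ℚ; 0ℚ; 1ℚ; _+_; _*_; _-_)
  import Data.Rational.Properties as ℚP
  open import Data.Fin as Fin using (Fin; zero; suc; _↑ˡ_; _↑ʳ_)
  open import Data.Vec using (Vec; []; _∷_; _∷ʳ_; lookup; tabulate)
  import Data.Vec.Properties as Vecₚ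
  open import Data.Vec.Relation.Unary.All using (All; []; _∷_)
  open import Data.Product using (Σ; _,_)
  open import Function using (_∘_)
  open import Relation.Nullary using (does)
  open import Relation.Binary.PropositionalEquality

  diagonal : ∀ {d} → (Fin d → ℚ) → Fin d → Fin d → ℚ
  diagonal s l i = if does (l Fin.≟ i) then s l else 0ℚ

  sum-diagonal : ∀ d (μ s : Fin d → ℚ) i → sumℚ d (λ l → μ l * diagonal s l i) ≡ μ i * s i
  sum-diagonal (suc d) μ s zero = trans
    (cong (λ r → μ zero * s zero + r) (trans (sum-cong d (λ l → ℚP.*-zeroʳ (μ (suc l)))) (sum-zero d)))
    (ℚP.+-identityʳ _)
  sum-diagonal (suc d) μ s (suc i) = trans
    (cong (_+ sumℚ d (λ l → μ (suc l) * diagonal s (suc l) (suc i))) (ℚP.*-zeroʳ (μ zero)))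
    (trans (ℚP.+-identityˡ _) (sum-diagonal d (μ ∘ suc) (s ∘ suc) i))

  diagonal⇒HasDimension : ∀ {d k} (V : Vec (Point d) (suc k)) (f : Fin d → Fin k) (s : Fin d → ℚ) →
                          (∀ l → s l ≢ 0ℚ) → (∀ l i → diffVec V (f l) i ≡ diagonal s l i) → HasDimension V d
  diagonal⇒HasDimension {d} {k} V f s s≢0 diff≡ = f , independent , spanning
    where
    1/s : Fin d → ℚ
    1/s l = (ℚ.1/ s l) {{ℚ.≢-nonZero (s≢0 l)}}
    s*1/s : ∀ l → s l * 1/s l ≡ 1ℚ
    s*1/s l = ℚP.*-inverseʳ (s l) {{ℚ.≢-nonZero (s≢0 l)}}
    combination : ∀ (μ : Fin d → ℚ) i → sumℚ d (λ l → μ l * diffVec V (f l) i) ≡ μ i * s i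
    combination μ i = trans (sum-cong d (λ l → cong (μ l *_) (diff≡ l i))) (sum-diagonal d μ s i)
    independent : (μ : Fin d → ℚ) → (∀ i → sumℚ d (λ l → μ l * diffVec V (f l) i) ≡ 0ℚ) →
                  ∀ l → μ l ≡ 0ℚ
    independent μ Σ≡0 l = begin
      μ l                   ≡⟨ sym (ℚP.*-identityʳ (μ l)) ⟩
      μ l * 1ℚ              ≡⟨ cong (μ l *_) (sym (s*1/s l)) ⟩
      μ l * (s l * 1/s l)   ≡⟨ sym (ℚP.*-assoc (μ l) (s l) (1/s l)) ⟩
      μ l * s l * 1/s l     ≡⟨ cong (_* 1/s l) (trans (sym (combination μ l)) (Σ≡0 l)) ⟩
      0ℚ * 1/s l            ≡⟨ ℚP.*-zeroˡ (1/s l) ⟩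
      0ℚ ∎
      where open ≡-Reasoning
    spanning : ∀ j → Σ (Fin d → ℚ) λ c → ∀ i → diffVec V j i ≡ sumℚ d (λ l → c l * diffVec V (f l) i)
    spanning j = c , λ i → sym (trans (combination c i) (c*s i))
      where
      c : Fin d → ℚ
      c l = diffVec V j l * 1/s l
      c*s : ∀ i → c i * s i ≡ diffVec V j i
      c*s i = trans (ℚP.*-assoc (diffVec V j i) (1/s i) (s i))
                    (trans (cong (diffVec V j i *_) (trans (ℚP.*-comm (1/s i) (s i)) (s*1/s i)))
                           (ℚP.*-identityʳ _))

  axis : ∀ n → Fin (suc n) → Fin (lastVertex n)
  axis zero    zero    = zero
  axis (suc n) zero    = lastVertex n ↑ʳ zero
  axis (suc n) (suc l) = axis n l ↑ˡ suc (lastVertex n)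

  onTop-origin : ∀ n → onTop n zero ≡ false
  onTop-origin zero    = refl
  onTop-origin (suc n) = onTop-origin n

  cayley-origin : ∀ n as bs i → lookup (cayley n as bs zero) i ≡ + 0
  cayley-origin zero    []       []       zero    = refl
  cayley-origin (suc n) (a ∷ as) (b ∷ bs) zero    = refl
  cayley-origin (suc n) (a ∷ as) (b ∷ bs) (suc i) = cayley-origin n as bs i

  cayley-axis : ∀ n as bs l i →
    lookup (cayley n as bs (suc (axis n l))) i ≡ (if does (l Fin.≟ i) then + lookup (as ∷ʳ 1) l else + 0)
  cayley-axis zero    []       []       zero    zero    = refl
  cayley-axis (suc n) (a ∷ as) (b ∷ bs) zero zero = trans
    (cong (λ p → lookup p zero) (cayley-top n a as b bs zero)) (cong (λ h → + (if h then b else a)) (onTop-origin n))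
  cayley-axis (suc n) (a ∷ as) (b ∷ bs) zero (suc i) = trans
    (cong (λ p → lookup p (suc i)) (cayley-top n a as b bs zero)) (cayley-origin n as bs i)
  cayley-axis (suc n) (a ∷ as) (b ∷ bs) (suc l) zero =
    cong (λ p → lookup p zero) (cayley-bottom n a as b bs (suc (axis n l)))
  cayley-axis (suc n) (a ∷ as) (b ∷ bs) (suc l) (suc i) = trans
    (cong (λ p → lookup p (suc i)) (cayley-bottom n a as b bs (suc (axis n l)))) (cayley-axis n as bs l i)

  cayley-dimension : ∀ n as bs → All (_≢ 0) as → HasDimension (tabulate (cayley n as bs)) (suc n)
  cayley-dimension n as bs as≢0 =
    diagonal⇒HasDimension (tabulate (cayley n as bs)) (axis n) s (ℕ→ℚ-≢0 ∘ axis-length≢0 as as≢0) diff≡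
    where
    s : Fin (suc n) → ℚ
    s l = ℕ→ℚ (lookup (as ∷ʳ 1) l)
    axis-length≢0 : ∀ {n} (as : Vec ℕ n) → All (_≢ 0) as → ∀ l → lookup (as ∷ʳ 1) l ≢ 0
    axis-length≢0 []       []          zero    = λ ()
    axis-length≢0 (a ∷ as) (a≢0 ∷ _)   zero    = a≢0
    axis-length≢0 (a ∷ as) (_ ∷ as≢0)  (suc l) = axis-length≢0 as as≢0 l
    diff≡ : ∀ l i → diffVec (tabulate (cayley n as bs)) (axis n l) i ≡ diagonal s l i
    diff≡ l i rewrite Vecₚ.lookup∘tabulate (cayley n as bs) (suc (axis n l))
                    | cayley-axis n as bs l i | cayley-origin n as bs i
      with does (l Fin.≟ i)
    ... | true  = ℚP.+-identityʳ _
    ... | false = refl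

module Antidiagonal where

  open import Data.Nat using (ℕ; zero; suc; _+_; _*_)
  import Data.Nat.Properties as ℕP
  open import Algebra.Properties.CommutativeSemigroup ℕP.+-commutativeSemigroup
    using () renaming (interchange to +-interchange)
  open import Data.List using (List; []; _∷_; [_]; _++_; map; length; concatMap)
  import Data.List.Properties as Listₚ
  open import Data.List.Membership.Propositional using (_∈_)
  open import Data.List.Membership.Propositional.Properties using (∈-map⁺; ∈-map⁻)
  open import Data.List.Relation.Unary.Any using (here; there)
  open import Data.List.Relation.Unary.All as All using ([])
  open import Data.List.Relation.Unary.AllPairs as AllPairs using ([]; _∷_)
  import Data.List.Relation.Unary.AllPairs.Properties as AllPairsₚ
  open import Data.Product using (_×_; _,_; proj₂; uncurry; map₁)
  open import Relation.Binary.PropositionalEquality hiding ([_])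

  private variable
    A : Set

  ∑antidiagonal : (ℕ → ℕ → ℕ) → ℕ → ℕ
  ∑antidiagonal H zero    = H 0 0
  ∑antidiagonal H (suc t) = H 0 (suc t) + ∑antidiagonal (λ u → H (suc u)) t

  ∑antidiagonal-cong : ∀ t {H H′ : ℕ → ℕ → ℕ} → (∀ u z → H u z ≡ H′ u z) →
                       ∑antidiagonal H t ≡ ∑antidiagonal H′ t
  ∑antidiagonal-cong zero    H≗H′ = H≗H′ 0 0
  ∑antidiagonal-cong (suc t) H≗H′ =
    cong₂ _+_ (H≗H′ 0 (suc t)) (∑antidiagonal-cong t (λ u → H≗H′ (suc u)))

  ∑antidiagonal-zero : ∀ t → ∑antidiagonal (λ _ _ → 0) t ≡ 0
  ∑antidiagonal-zero zero    = refl
  ∑antidiagonal-zero (suc t) = ∑antidiagonal-zero t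

  ∑antidiagonal-+ : ∀ t (H H′ : ℕ → ℕ → ℕ) →
                    ∑antidiagonal (λ u z → H u z + H′ u z) t ≡ ∑antidiagonal H t + ∑antidiagonal H′ t
  ∑antidiagonal-+ zero    H H′ = refl
  ∑antidiagonal-+ (suc t) H H′ =
    trans (cong (H 0 (suc t) + H′ 0 (suc t) +_) (∑antidiagonal-+ t (λ u → H (suc u)) (λ u → H′ (suc u))))
          (+-interchange (H 0 (suc t)) (H′ 0 (suc t)) _ _)

  ∑antidiagonal-*ˡ : ∀ t c (H : ℕ → ℕ → ℕ) →
                     ∑antidiagonal (λ u z → c * H u z) t ≡ c * ∑antidiagonal H t
  ∑antidiagonal-*ˡ zero    c H = refl
  ∑antidiagonal-*ˡ (suc t) c H = trans (cong (c * H 0 (suc t) +_) (∑antidiagonal-*ˡ t c (λ u → H (suc u))))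
                                       (sym (ℕP.*-distribˡ-+ c (H 0 (suc t)) _))

  antidiagonal : ℕ → List (ℕ × ℕ)
  antidiagonal zero    = [ (0 , 0) ]
  antidiagonal (suc t) = (0 , suc t) ∷ map (map₁ suc) (antidiagonal t)

  ∈-antidiagonal⁻ : ∀ t {u z} → (u , z) ∈ antidiagonal t → u + z ≡ t
  ∈-antidiagonal⁻ zero    (here refl) = refl
  ∈-antidiagonal⁻ (suc t) (here refl) = refl
  ∈-antidiagonal⁻ (suc t) (there p) with ∈-map⁻ (map₁ suc) p
  ... | _ , p′ , refl = cong suc (∈-antidiagonal⁻ t p′)

  ∈-antidiagonal⁺ : ∀ {t} u z → u + z ≡ t → (u , z) ∈ antidiagonal t
  ∈-antidiagonal⁺ zero    zero    refl = here refl
  ∈-antidiagonal⁺ zero    (suc z) refl = here refl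
  ∈-antidiagonal⁺ (suc u) z       refl = there (∈-map⁺ (map₁ suc) (∈-antidiagonal⁺ u z refl))

  antidiagonal-heights-distinct : ∀ t → AllPairs.AllPairs (λ p q → proj₂ p ≢ proj₂ q) (antidiagonal t)
  antidiagonal-heights-distinct zero    = [] ∷ []
  antidiagonal-heights-distinct (suc t) =
    All.tabulate top-unique ∷ AllPairsₚ.map⁺ (antidiagonal-heights-distinct t)
    where
    top-unique : ∀ {p} → p ∈ map (map₁ suc) (antidiagonal t) → suc t ≢ proj₂ p
    top-unique p∈ t+1≡z with ∈-map⁻ (map₁ suc) p∈
    ... | (u , z) , q∈ , refl = ℕP.m≢1+n+m z (trans (sym t+1≡z) (sym (cong suc (∈-antidiagonal⁻ t q∈))))

  length-concatMap-antidiagonal : ∀ (f : ℕ → ℕ → List A) t →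
    length (concatMap (uncurry f) (antidiagonal t)) ≡ ∑antidiagonal (λ u z → length (f u z)) t
  length-concatMap-antidiagonal f zero    = cong length (Listₚ.++-identityʳ (f 0 0))
  length-concatMap-antidiagonal f (suc t) = begin
    length (f 0 (suc t) ++ concatMap (uncurry f) (map (map₁ suc) (antidiagonal t)))
      ≡⟨ Listₚ.length-++ (f 0 (suc t)) ⟩
    length (f 0 (suc t)) + length (concatMap (uncurry f) (map (map₁ suc) (antidiagonal t)))
      ≡⟨ cong (λ l → length (f 0 (suc t)) + length l)
              (Listₚ.concatMap-map (uncurry f) (map₁ suc) (antidiagonal t)) ⟩
    length (f 0 (suc t)) + length (concatMap (uncurry (λ u → f (suc u))) (antidiagonal t))
      ≡⟨ cong (length (f 0 (suc t)) +_) (length-concatMap-antidiagonal (λ u → f (suc u)) t) ⟩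
    ∑antidiagonal (λ u z → length (f u z)) (suc t) ∎
    where open ≡-Reasoning

module LatticePoints where

  open import Defs
  open CayleyPolytope
  open Antidiagonal
  open import Data.Nat as ℕ using (ℕ; zero; suc; _+_; _*_)
  import Data.Nat.Properties as ℕP
  open import Data.Integer using (+_)
  import Data.Integer.Properties as ℤP
  open import Data.Vec using (Vec; []; _∷_)
  open import Data.List using (List; []; _∷_; [_]; map; length; concatMap; cartesianProductWith; upTo)
  import Data.List.Properties as Listₚ
  open import Data.List.Membership.Propositional using (_∈_; find; lose)
  open import Data.List.Membership.Propositional.Properties
    using (∈-concatMap⁺; ∈-concatMap⁻; ∈-cartesianProductWith⁺; ∈-cartesianProductWith⁻;
           ∈-upTo⁺; ∈-upTo⁻)
  open import Data.List.Relation.Unary.Any using (here)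
  open import Data.List.Relation.Unary.All as All using ([]; _∷_)
  import Data.List.Relation.Unary.All.Properties as Allₚ
  open import Data.List.Relation.Unary.AllPairs as AllPairs using ([]; _∷_)
  import Data.List.Relation.Unary.AllPairs.Properties as AllPairsₚ
  open import Data.List.Relation.Unary.Unique.Propositional using (Unique)
  open import Data.List.Relation.Binary.Disjoint.Propositional using (Disjoint)
  import Data.List.Relation.Unary.Unique.Propositional.Properties as Uniqueₚ
  open import Data.Product using (_×_; _,_; proj₁; proj₂; uncurry)
  open import Function using (_⇔_; mk⇔)
  open import Relation.Binary.PropositionalEquality hiding ([_])

  private variable
    A B C : Set

  length-cartesianProductWith : ∀ (f : A → B → C) xs ys →
                                length (cartesianProductWith f xs ys) ≡ length xs * length ys
  length-cartesianProductWith f []       ys = refl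
  length-cartesianProductWith f (x ∷ xs) ys = trans (Listₚ.length-++ (map (f x) ys))
    (cong₂ _+_ (Listₚ.length-map (f x) ys) (length-cartesianProductWith f xs ys))

  slice : ∀ n → Vec ℕ n → Vec ℕ n → ℕ → ℕ → List (Point (suc n))
  slice zero    []       []       u z = [ + z ∷ [] ]
  slice (suc n) (a ∷ as) (b ∷ bs) u z =
    cartesianProductWith (λ y x → + y ∷ x) (upTo (suc (a * u + b * z))) (slice n as bs u z)

  sliceSize : ∀ n → Vec ℕ n → Vec ℕ n → ℕ → ℕ → ℕ
  sliceSize zero    []       []       u z = 1
  sliceSize (suc n) (a ∷ as) (b ∷ bs) u z = suc (a * u + b * z) * sliceSize n as bs u z

  ∈-slice⁺ : ∀ n as bs u z x → InSlice n as bs u z x → x ∈ slice n as bs u z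
  ∈-slice⁺ zero    []       []       u z (w ∷ []) refl = here refl
  ∈-slice⁺ (suc n) (a ∷ as) (b ∷ bs) u z (w ∷ x) ((y , refl , y≤L) , x∈) =
    ∈-cartesianProductWith⁺ (λ y x → + y ∷ x) (∈-upTo⁺ (ℕ.s≤s y≤L)) (∈-slice⁺ n as bs u z x x∈)

  ∈-slice⁻ : ∀ n as bs u z x → x ∈ slice n as bs u z → InSlice n as bs u z x
  ∈-slice⁻ zero    []       []       u z (w ∷ []) (here refl) = refl
  ∈-slice⁻ (suc n) (a ∷ as) (b ∷ bs) u z (w ∷ x) p
    with ∈-cartesianProductWith⁻ (λ y x → + y ∷ x) (upTo (suc (a * u + b * z))) (slice n as bs u z) p
  ... | y , x , y∈ , x∈ , refl = (y , refl , ℕP.≤-pred (∈-upTo⁻ y∈)) , ∈-slice⁻ n as bs u z x x∈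

  slice-unique : ∀ n as bs u z → Unique (slice n as bs u z)
  slice-unique zero    []       []       u z = [] ∷ []
  slice-unique (suc n) (a ∷ as) (b ∷ bs) u z =
    Uniqueₚ.cartesianProductWith⁺ (λ y x → + y ∷ x) ∷-injective
      (Uniqueₚ.upTo⁺ (suc (a * u + b * z))) (slice-unique n as bs u z)
    where
    ∷-injective : ∀ {y y′} {x x′ : Point (suc n)} → + y ∷ x ≡ + y′ ∷ x′ → y ≡ y′ × x ≡ x′
    ∷-injective refl = refl , refl

  length-slice : ∀ n as bs u z → length (slice n as bs u z) ≡ sliceSize n as bs u z
  length-slice zero    []       []       u z = refl
  length-slice (suc n) (a ∷ as) (b ∷ bs) u z =
    trans (length-cartesianProductWith (λ y x → + y ∷ x) (upTo (suc (a * u + b * z))) (slice n as bs u z))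
          (cong₂ _*_ (Listₚ.length-upTo (suc (a * u + b * z))) (length-slice n as bs u z))

  latticePoints : ∀ n → Vec ℕ n → Vec ℕ n → ℕ → List (Point (suc n))
  latticePoints n as bs t = concatMap (uncurry (slice n as bs)) (antidiagonal t)

  ∈-latticePoints : ∀ n as bs t x → x ∈ latticePoints n as bs t ⇔ CayleyLatticePoint n as bs t x
  ∈-latticePoints n as bs t x = mk⇔ to from
    where
    to : x ∈ latticePoints n as bs t → CayleyLatticePoint n as bs t x
    to x∈ with find (∈-concatMap⁻ (uncurry (slice n as bs)) x∈)
    ... | (u , z) , p∈ , x∈slice = u , z , ∈-antidiagonal⁻ t p∈ , ∈-slice⁻ n as bs u z x x∈slice
    from : CayleyLatticePoint n as bs t x → x ∈ latticePoints n as bs t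
    from (u , z , u+z≡t , x∈slice) = ∈-concatMap⁺ (uncurry (slice n as bs))
      (lose {P = λ p → x ∈ uncurry (slice n as bs) p}
            (∈-antidiagonal⁺ u z u+z≡t) (∈-slice⁺ n as bs u z x x∈slice))

  latticePoints-unique : ∀ n as bs t → Unique (latticePoints n as bs t)
  latticePoints-unique n as bs t = Uniqueₚ.concat⁺
    (Allₚ.map⁺ (All.tabulate (λ {p} _ → slice-unique n as bs (proj₁ p) (proj₂ p))))
    (AllPairsₚ.map⁺ (AllPairs.map disjoint (antidiagonal-heights-distinct t)))
    where
    disjoint : ∀ {p q} → proj₂ p ≢ proj₂ q → Disjoint (uncurry (slice n as bs) p) (uncurry (slice n as bs) q)
    disjoint {u , z} {u′ , z′} z≢z′ {x} (x∈ , x∈′) = z≢z′ (ℤP.+-injective (trans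
      (sym (InSlice-height n as bs x (∈-slice⁻ n as bs u z x x∈)))
      (InSlice-height n as bs x (∈-slice⁻ n as bs u′ z′ x x∈′))))

  length-latticePoints : ∀ n as bs t → length (latticePoints n as bs t) ≡ ∑antidiagonal (sliceSize n as bs) t
  length-latticePoints n as bs t = trans (length-concatMap-antidiagonal (slice n as bs) t)
    (∑antidiagonal-cong t (length-slice n as bs))

module Binomials where

  open Antidiagonal
  open import Data.Nat using (ℕ; zero; suc; _+_; _*_)
  import Data.Nat.Properties as ℕP
  open import Data.Nat.Solver using (module +-*-Solver)
  open import Data.List using (List; []; _∷_; map)
  open import Relation.Binary.PropositionalEquality
  open +-*-Solver

  binomial : ℕ → ℕ → ℕ
  binomial x       zero    = 1
  binomial zero    (suc k) = 0
  binomial (suc x) (suc k) = binomial x k + binomial x (suc k)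

  binomial-1 : ∀ x → binomial x 1 ≡ x
  binomial-1 zero    = refl
  binomial-1 (suc x) = cong suc (binomial-1 x)

  *-binomial : ∀ x k → x * binomial x k ≡ suc k * binomial x (suc k) + k * binomial x k
  *-binomial zero    zero    = refl
  *-binomial zero    (suc k) = sym (cong₂ _+_ (ℕP.*-zeroʳ (suc (suc k))) (ℕP.*-zeroʳ (suc k)))
  *-binomial (suc x) zero    rewrite binomial-1 x =
    solve 1 (λ x → (con 1 :+ x) :* con 1 := con 1 :* (con 1 :+ x) :+ con 0 :* con 1) refl x
  *-binomial (suc x) (suc k) = begin
    suc x * (A + B)
      ≡⟨ solve 3 (λ x A B → (con 1 :+ x) :* (A :+ B) := A :+ B :+ x :* A :+ x :* B) refl x A B ⟩
    A + B + x * A + x * B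
      ≡⟨ cong₂ (λ p q → A + B + p + q) (*-binomial x k) (*-binomial x (suc k)) ⟩
    A + B + (suc k * B + k * A) + (suc (suc k) * C + suc k * B)
      ≡⟨ solve 4 (λ k A B C → A :+ B :+ ((con 1 :+ k) :* B :+ k :* A) :+ ((con 2 :+ k) :* C :+ (con 1 :+ k) :* B)
                            := (con 2 :+ k) :* (B :+ C) :+ (con 1 :+ k) :* (A :+ B)) refl k A B C ⟩
    suc (suc k) * (B + C) + suc k * (A + B) ∎
    where
    open ≡-Reasoning
    A = binomial x k
    B = binomial x (suc k)
    C = binomial x (suc (suc k))

  ∑antidiagonal-binomial : ∀ t α β →
    ∑antidiagonal (λ u z → binomial u α * binomial z β) t ≡ binomial (suc t) (suc (α + β))
  ∑antidiagonal-binomial zero    zero    zero    = refl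
  ∑antidiagonal-binomial zero    zero    (suc β) = refl
  ∑antidiagonal-binomial zero    (suc α) β       = refl
  ∑antidiagonal-binomial (suc t) zero    β       =
    cong₂ _+_ (ℕP.+-identityʳ (binomial (suc t) β)) (∑antidiagonal-binomial t zero β)
  ∑antidiagonal-binomial (suc t) (suc α) β = begin
    0 + ∑antidiagonal (λ u z → (binomial u α + binomial u (suc α)) * binomial z β) t
      ≡⟨ ∑antidiagonal-cong t (λ u z → ℕP.*-distribʳ-+ (binomial z β) (binomial u α) (binomial u (suc α))) ⟩
    ∑antidiagonal (λ u z → binomial u α * binomial z β + binomial u (suc α) * binomial z β) t
      ≡⟨ ∑antidiagonal-+ t _ _ ⟩
    ∑antidiagonal (λ u z → binomial u α * binomial z β) t +
    ∑antidiagonal (λ u z → binomial u (suc α) * binomial z β) t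
      ≡⟨ cong₂ _+_ (∑antidiagonal-binomial t α β) (∑antidiagonal-binomial t (suc α) β) ⟩
    binomial (suc t) (suc (α + β)) + binomial (suc t) (suc (suc α + β)) ∎
    where open ≡-Reasoning

  module Coefficientwise {C : Set} (_+ᶜ_ : C → C → C) where

    infixl 6 _⊕_
    _⊕_ : List C → List C → List C
    []      ⊕ q       = q
    (a ∷ p) ⊕ []      = a ∷ p
    (a ∷ p) ⊕ (b ∷ q) = (a +ᶜ b) ∷ (p ⊕ q)

  -- Lists [c₀, c₁, …] standing for Σᵢ cᵢ (x choose k+i), with coefficients in an ℕ-module C.
  module BinomialBasis {C : Set} (0ᶜ : C) (_+ᶜ_ : C → C → C) (_·ᶜ_ : ℕ → C → C) where

    open Coefficientwise _+ᶜ_ public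

    scale : ℕ → List C → List C
    scale n = map (n ·ᶜ_)

    weigh : ℕ → List C → List C
    weigh k []       = []
    weigh k (c ∷ cs) = k ·ᶜ c ∷ weigh (suc k) cs

    -- Multiplication by x, following x (x choose k) = (k+1) (x choose k+1) + k (x choose k).
    timesX : ℕ → List C → List C
    timesX k p = weigh k p ⊕ (0ᶜ ∷ weigh (suc k) p)

    module Evaluation (⟦_⟧ : C → ℕ) (⟦0⟧ : ⟦ 0ᶜ ⟧ ≡ 0)
                      (⟦+⟧ : ∀ a b → ⟦ a +ᶜ b ⟧ ≡ ⟦ a ⟧ + ⟦ b ⟧) (⟦·⟧ : ∀ n a → ⟦ n ·ᶜ a ⟧ ≡ n * ⟦ a ⟧) where

      eval : ℕ → List C → ℕ → ℕ
      eval k []       x = 0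
      eval k (c ∷ cs) x = binomial x k * ⟦ c ⟧ + eval (suc k) cs x

      eval-⊕ : ∀ k p q x → eval k (p ⊕ q) x ≡ eval k p x + eval k q x
      eval-⊕ k []      q       x = refl
      eval-⊕ k (a ∷ p) []      x = sym (ℕP.+-identityʳ _)
      eval-⊕ k (a ∷ p) (b ∷ q) x rewrite ⟦+⟧ a b | eval-⊕ (suc k) p q x =
        solve 5 (λ B a b P Q → B :* (a :+ b) :+ (P :+ Q) := B :* a :+ P :+ (B :* b :+ Q)) refl
          (binomial x k) ⟦ a ⟧ ⟦ b ⟧ (eval (suc k) p x) (eval (suc k) q x)

      eval-map : ∀ {f : C → C} m → (∀ c → ⟦ f c ⟧ ≡ m * ⟦ c ⟧) →
                 ∀ k p x → eval k (map f p) x ≡ m * eval k p x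
      eval-map m f≡ k []      x = sym (ℕP.*-zeroʳ m)
      eval-map m f≡ k (c ∷ p) x rewrite f≡ c | eval-map m f≡ (suc k) p x =
        solve 4 (λ B m c P → B :* (m :* c) :+ m :* P := m :* (B :* c :+ P))
                refl (binomial x k) m ⟦ c ⟧ (eval (suc k) p x)

      eval-scale : ∀ k n p x → eval k (scale n p) x ≡ n * eval k p x
      eval-scale k n = eval-map n (⟦·⟧ n) k

      eval-weigh : ∀ k p x → x * eval k p x ≡ eval k (weigh k p) x + eval (suc k) (weigh (suc k) p) x
      eval-weigh k []      x = ℕP.*-zeroʳ x
      eval-weigh k (c ∷ p) x rewrite ⟦·⟧ k c | ⟦·⟧ (suc k) c = begin
        x * (B * ⟦ c ⟧ + E)
          ≡⟨ solve 4 (λ x B c E → x :* (B :* c :+ E) := x :* B :* c :+ x :* E) refl x B ⟦ c ⟧ E ⟩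
        x * B * ⟦ c ⟧ + x * E
          ≡⟨ cong₂ (λ p q → p * ⟦ c ⟧ + q) (*-binomial x k) (eval-weigh (suc k) p x) ⟩
        (suc k * B′ + k * B) * ⟦ c ⟧ + (P + Q)
          ≡⟨ solve 6 (λ k B B′ c P Q → ((con 1 :+ k) :* B′ :+ k :* B) :* c :+ (P :+ Q)
                                     := B :* (k :* c) :+ P :+ (B′ :* ((con 1 :+ k) :* c) :+ Q)) refl k B B′ ⟦ c ⟧ P Q ⟩
        B * (k * ⟦ c ⟧) + P + (B′ * (suc k * ⟦ c ⟧) + Q) ∎
        where
        open ≡-Reasoning
        B  = binomial x k
        B′ = binomial x (suc k)
        E  = eval (suc k) p x
        P  = eval (suc k) (weigh (suc k) p) x
        Q  = eval (suc (suc k)) (weigh (suc (suc k)) p) x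

      eval-timesX : ∀ k p x → eval k (timesX k p) x ≡ x * eval k p x
      eval-timesX k p x = begin
        eval k (weigh k p ⊕ (0ᶜ ∷ weigh (suc k) p)) x  ≡⟨ eval-⊕ k (weigh k p) (0ᶜ ∷ weigh (suc k) p) x ⟩
        W + (binomial x k * ⟦ 0ᶜ ⟧ + W′)                ≡⟨ cong (λ c → W + (binomial x k * c + W′)) ⟦0⟧ ⟩
        W + (binomial x k * 0 + W′)                     ≡⟨ cong (λ c → W + (c + W′)) (ℕP.*-zeroʳ (binomial x k)) ⟩
        W + W′                                          ≡⟨ sym (eval-weigh k p x) ⟩
        x * eval k p x                                  ∎
        where
        open ≡-Reasoning
        W  = eval k (weigh k p) x
        W′ = eval (suc k) (weigh (suc k) p) x

module CountingPolynomial where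

  open Antidiagonal
  open LatticePoints using (sliceSize)
  open Binomials
  open import Data.Nat using (ℕ; zero; suc; _+_; _*_)
  import Data.Nat.Properties as ℕP
  open import Data.Nat.Solver using (module +-*-Solver)
  open import Data.List using (List; []; _∷_; [_]; map; replicate; _++_)
  open import Data.Vec using (Vec; []; _∷_)
  open import Function using (id)
  open import Relation.Binary.PropositionalEquality hiding ([_])
  open +-*-Solver

  module Univariate = BinomialBasis 0 _+_ _*_
  open Univariate using () renaming (_⊕_ to _⊕₁_; scale to scale₁; timesX to timesX₁)
  open Univariate.Evaluation id refl (λ _ _ → refl) (λ _ _ → refl) public using ()
    renaming (eval to eval₁; eval-⊕ to eval₁-⊕; eval-scale to eval₁-scale; eval-timesX to eval₁-timesX)

  module Bivariate = BinomialBasis [] _⊕₁_ scale₁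
  open Bivariate using () renaming (_⊕_ to _⊕₂_; scale to scale₂; timesX to timesX₂)
  module Bivariate-Evaluation (z : ℕ) =
    Bivariate.Evaluation (λ q → eval₁ 0 q z) refl (λ p q → eval₁-⊕ 0 p q z) (λ n q → eval₁-scale 0 n q z)

  -- eval₂ k P u z = Σ_α (u choose k+α) Pα(z)
  eval₂ : ℕ → List (List ℕ) → ℕ → ℕ → ℕ
  eval₂ k P u z = Bivariate-Evaluation.eval z k P u

  shift : ℕ → List ℕ → List ℕ
  shift j q = replicate j 0 ++ q

  eval₁-shift : ∀ j k q x → eval₁ k (shift j q) x ≡ eval₁ (j + k) q x
  eval₁-shift zero    k q x = refl
  eval₁-shift (suc j) k q x = trans (cong (_+ eval₁ (suc k) (shift j q) x) (ℕP.*-zeroʳ (binomial x k)))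
                                    (trans (eval₁-shift j (suc k) q x) (cong (λ i → eval₁ i q x) (ℕP.+-suc j k)))

  ∑antidiagonal-binomial-eval₁ : ∀ t α β q →
    ∑antidiagonal (λ u z → binomial u α * eval₁ β q z) t ≡ eval₁ (suc (α + β)) q (suc t)
  ∑antidiagonal-binomial-eval₁ t α β []      =
    trans (∑antidiagonal-cong t (λ u z → ℕP.*-zeroʳ (binomial u α))) (∑antidiagonal-zero t)
  ∑antidiagonal-binomial-eval₁ t α β (c ∷ q) = begin
    ∑antidiagonal (λ u z → binomial u α * (binomial z β * c + eval₁ (suc β) q z)) t
      ≡⟨ ∑antidiagonal-cong t (λ u z → solve 4 (λ A B c E → A :* (B :* c :+ E) := c :* (A :* B) :+ A :* E) refl
                                                  (binomial u α) (binomial z β) c (eval₁ (suc β) q z)) ⟩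
    ∑antidiagonal (λ u z → c * (binomial u α * binomial z β) + binomial u α * eval₁ (suc β) q z) t
      ≡⟨ ∑antidiagonal-+ t _ _ ⟩
    ∑antidiagonal (λ u z → c * (binomial u α * binomial z β)) t +
    ∑antidiagonal (λ u z → binomial u α * eval₁ (suc β) q z) t
      ≡⟨ cong₂ _+_ (trans (∑antidiagonal-*ˡ t c _) (cong (c *_) (∑antidiagonal-binomial t α β)))
                   (∑antidiagonal-binomial-eval₁ t α (suc β) q) ⟩
    c * binomial (suc t) (suc (α + β)) + eval₁ (suc (α + suc β)) q (suc t)
      ≡⟨ cong₂ _+_ (ℕP.*-comm c _) (cong (λ i → eval₁ (suc i) q (suc t)) (ℕP.+-suc α β)) ⟩
    binomial (suc t) (suc (α + β)) * c + eval₁ (suc (suc (α + β))) q (suc t) ∎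
    where open ≡-Reasoning

  collapse : ℕ → List (List ℕ) → List ℕ
  collapse k []      = []
  collapse k (q ∷ Q) = shift (suc k) q ⊕₁ collapse (suc k) Q

  ∑antidiagonal-eval₂ : ∀ t k Q → ∑antidiagonal (eval₂ k Q) t ≡ eval₁ 0 (collapse k Q) (suc t)
  ∑antidiagonal-eval₂ t k []      = ∑antidiagonal-zero t
  ∑antidiagonal-eval₂ t k (q ∷ Q) = begin
    ∑antidiagonal (λ u z → binomial u k * eval₁ 0 q z + eval₂ (suc k) Q u z) t
      ≡⟨ ∑antidiagonal-+ t _ _ ⟩
    ∑antidiagonal (λ u z → binomial u k * eval₁ 0 q z) t + ∑antidiagonal (eval₂ (suc k) Q) t
      ≡⟨ cong₂ _+_ (trans (∑antidiagonal-binomial-eval₁ t k 0 q) (sym (eval₁-shift (suc k) 0 q (suc t))))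
                   (∑antidiagonal-eval₂ t (suc k) Q) ⟩
    eval₁ 0 (shift (suc k) q) (suc t) + eval₁ 0 (collapse (suc k) Q) (suc t)
      ≡⟨ sym (eval₁-⊕ 0 (shift (suc k) q) (collapse (suc k) Q) (suc t)) ⟩
    eval₁ 0 (collapse k (q ∷ Q)) (suc t) ∎
    where open ≡-Reasoning

  linearFactor : ℕ → ℕ → List (List ℕ) → List (List ℕ)
  linearFactor a b P = P ⊕₂ (scale₂ a (timesX₂ 0 P) ⊕₂ scale₂ b (map (timesX₁ 0) P))

  eval₂-linearFactor : ∀ a b P u z → eval₂ 0 (linearFactor a b P) u z ≡ suc (a * u + b * z) * eval₂ 0 P u z
  eval₂-linearFactor a b P u z = begin
    eval₂ 0 (P ⊕₂ (scale₂ a (timesX₂ 0 P) ⊕₂ scale₂ b (map (timesX₁ 0) P))) u z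
      ≡⟨ trans (E.eval-⊕ 0 P _ u) (cong (eval₂ 0 P u z +_) (E.eval-⊕ 0 (scale₂ a (timesX₂ 0 P)) _ u)) ⟩
    E + (eval₂ 0 (scale₂ a (timesX₂ 0 P)) u z + eval₂ 0 (scale₂ b (map (timesX₁ 0) P)) u z)
      ≡⟨ cong (E +_) (cong₂ _+_ (trans (E.eval-scale 0 a (timesX₂ 0 P) u) (cong (a *_) (E.eval-timesX 0 P u)))
                                (trans (E.eval-scale 0 b (map (timesX₁ 0) P) u)
                                       (cong (b *_) (E.eval-map {timesX₁ 0} z (λ q → eval₁-timesX 0 q z) 0 P u)))) ⟩
    E + (a * (u * E) + b * (z * E))
      ≡⟨ solve 5 (λ a b u z E → E :+ (a :* (u :* E) :+ b :* (z :* E)) := (con 1 :+ (a :* u :+ b :* z)) :* E)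
                 refl a b u z E ⟩
    suc (a * u + b * z) * E ∎
    where
    open ≡-Reasoning
    module E = Bivariate-Evaluation z
    E = eval₂ 0 P u z

  slicePolynomial : ∀ {n} → Vec ℕ n → Vec ℕ n → List (List ℕ)
  slicePolynomial []       []       = [ [ 1 ] ]
  slicePolynomial (a ∷ as) (b ∷ bs) = linearFactor a b (slicePolynomial as bs)

  eval₂-slicePolynomial : ∀ n as bs u z → eval₂ 0 (slicePolynomial as bs) u z ≡ sliceSize n as bs u z
  eval₂-slicePolynomial zero    []       []       u z = refl
  eval₂-slicePolynomial (suc n) (a ∷ as) (b ∷ bs) u z =
    trans (eval₂-linearFactor a b (slicePolynomial as bs) u z)
          (cong (suc (a * u + b * z) *_) (eval₂-slicePolynomial n as bs u z))

  countingPolynomial : ∀ {n} → Vec ℕ n → Vec ℕ n → List ℕ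
  countingPolynomial as bs = collapse 0 (slicePolynomial as bs)

  ∑antidiagonal-sliceSize : ∀ n as bs t →
                            ∑antidiagonal (sliceSize n as bs) t ≡ eval₁ 0 (countingPolynomial as bs) (suc t)
  ∑antidiagonal-sliceSize n as bs t = trans (∑antidiagonal-cong t (λ u z → sym (eval₂-slicePolynomial n as bs u z)))
                                            (∑antidiagonal-eval₂ t 0 (slicePolynomial as bs))

module MonomialBasis where

  open import Defs
  open RationalCasts
  open FiniteSums
  open Binomials using (binomial; *-binomial; module Coefficientwise)
  open CountingPolynomial using (eval₁)
  open import Data.Nat as ℕ using (ℕ; zero; suc)
  open import Data.Rational using (ℚ; 0ℚ; 1ℚ; _+_; _*_; _-_)
  import Data.Rational.Properties as ℚP
  open import Data.Rational.Solver using (module +-*-Solver)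
  open import Data.Fin using (toℕ)
  open import Data.List using (List; []; _∷_; [_]; map; length)
  open import Relation.Binary.PropositionalEquality hiding ([_])
  open +-*-Solver
  open Coefficientwise _+_

  horner : List ℚ → ℚ → ℚ
  horner []       x = 0ℚ
  horner (c ∷ cs) x = c + x * horner cs x

  horner-⊕ : ∀ p q x → horner (p ⊕ q) x ≡ horner p x + horner q x
  horner-⊕ []      q       x = sym (ℚP.+-identityˡ _)
  horner-⊕ (a ∷ p) []      x = sym (ℚP.+-identityʳ _)
  horner-⊕ (a ∷ p) (b ∷ q) x rewrite horner-⊕ p q x =
    solve 5 (λ a b x P Q → a :+ b :+ x :* (P :+ Q) := a :+ x :* P :+ (b :+ x :* Q)) refl a b x (horner p x) (horner q x)

  scale : ℚ → List ℚ → List ℚ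
  scale c = map (c *_)

  horner-scale : ∀ c p x → horner (scale c p) x ≡ c * horner p x
  horner-scale c []      x = sym (ℚP.*-zeroʳ c)
  horner-scale c (a ∷ p) x rewrite horner-scale c p x =
    solve 4 (λ c a x P → c :* a :+ x :* (c :* P) := c :* (a :+ x :* P)) refl c a x (horner p x)

  timesAffine : ℚ → ℚ → List ℚ → List ℚ
  timesAffine α β p = scale α p ⊕ (0ℚ ∷ scale β p)

  horner-timesAffine : ∀ α β p x → horner (timesAffine α β p) x ≡ (α + β * x) * horner p x
  horner-timesAffine α β p x
    rewrite horner-⊕ (scale α p) (0ℚ ∷ scale β p) x | horner-scale α p x | horner-scale β p x =
    solve 4 (λ α β x E → α :* E :+ (con 0ℚ :+ x :* (β :* E)) := (α :+ β :* x) :* E)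
            refl α β x (horner p x)

  -- The coefficients of (t+1 choose k) as a polynomial in t, from
  -- (t+1 choose k+1) = (t+1 choose k) · (t+1-k)/(k+1).
  binomialMonomials : ℕ → List ℚ
  binomialMonomials zero    = [ 1ℚ ]
  binomialMonomials (suc k) = timesAffine ((1ℚ - ℕ→ℚ k) * recip-suc k) (recip-suc k) (binomialMonomials k)

  horner-binomialMonomials : ∀ k t → horner (binomialMonomials k) (ℕ→ℚ t) ≡ ℕ→ℚ (binomial (suc t) k)
  horner-binomialMonomials zero    t = solve 1 (λ x → con 1ℚ :+ x :* con 0ℚ := con 1ℚ) refl (ℕ→ℚ t)
  horner-binomialMonomials (suc k) t = begin
    horner (binomialMonomials (suc k)) T
      ≡⟨ horner-timesAffine ((1ℚ - K) * I) I (binomialMonomials k) T ⟩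
    ((1ℚ - K) * I + I * T) * horner (binomialMonomials k) T
      ≡⟨ cong (((1ℚ - K) * I + I * T) *_) (horner-binomialMonomials k t) ⟩
    ((1ℚ - K) * I + I * T) * B
      ≡⟨ solve 4 (λ K I T B → ((con 1ℚ :- K) :* I :+ I :* T) :* B := I :* ((con 1ℚ :+ T) :* B :- K :* B))
                 refl K I T B ⟩
    I * ((1ℚ + T) * B - K * B)
      ≡⟨ cong (λ p → I * (p - K * B)) absorption ⟩
    I * (K * B + K′ * B′ - K * B)
      ≡⟨ solve 5 (λ I K B K′ B′ → I :* (K :* B :+ K′ :* B′ :- K :* B) := (I :* K′) :* B′) refl I K B K′ B′ ⟩
    (I * K′) * B′
      ≡⟨ cong (_* B′) (recip-suc-inverseˡ k) ⟩
    1ℚ * B′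
      ≡⟨ ℚP.*-identityˡ B′ ⟩
    B′ ∎
    where
    open ≡-Reasoning
    T  = ℕ→ℚ t
    I  = recip-suc k
    K  = ℕ→ℚ k
    K′ = ℕ→ℚ (suc k)
    B  = ℕ→ℚ (binomial (suc t) k)
    B′ = ℕ→ℚ (binomial (suc t) (suc k))
    absorption : (1ℚ + T) * B ≡ K * B + K′ * B′
    absorption = begin
      (1ℚ + T) * B                                   ≡⟨ cong (_* B) (sym (ℕ→ℚ-+ 1 t)) ⟩
      ℕ→ℚ (suc t) * B                                ≡⟨ sym (ℕ→ℚ-* (suc t) (binomial (suc t) k)) ⟩
      ℕ→ℚ (suc t ℕ.* binomial (suc t) k)             ≡⟨ cong ℕ→ℚ (*-binomial (suc t) k) ⟩
      ℕ→ℚ (suc k ℕ.* binomial (suc t) (suc k) ℕ.+ k ℕ.* binomial (suc t) k)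
        ≡⟨ trans (ℕ→ℚ-+ (suc k ℕ.* binomial (suc t) (suc k)) (k ℕ.* binomial (suc t) k))
                 (cong₂ _+_ (ℕ→ℚ-* (suc k) (binomial (suc t) (suc k))) (ℕ→ℚ-* k (binomial (suc t) k))) ⟩
      K′ * B′ + K * B                                ≡⟨ ℚP.+-comm (K′ * B′) (K * B) ⟩
      K * B + K′ * B′ ∎

  toMonomials : ℕ → List ℕ → List ℚ
  toMonomials k []       = []
  toMonomials k (c ∷ cs) = scale (ℕ→ℚ c) (binomialMonomials k) ⊕ toMonomials (suc k) cs

  horner-toMonomials : ∀ k cs t → horner (toMonomials k cs) (ℕ→ℚ t) ≡ ℕ→ℚ (eval₁ k cs (suc t))
  horner-toMonomials k []       t = refl
  horner-toMonomials k (c ∷ cs) t = begin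
    horner (scale (ℕ→ℚ c) (binomialMonomials k) ⊕ toMonomials (suc k) cs) T
      ≡⟨ horner-⊕ (scale (ℕ→ℚ c) (binomialMonomials k)) (toMonomials (suc k) cs) T ⟩
    horner (scale (ℕ→ℚ c) (binomialMonomials k)) T + horner (toMonomials (suc k) cs) T
      ≡⟨ cong₂ _+_ (trans (horner-scale (ℕ→ℚ c) (binomialMonomials k) T)
                          (cong (ℕ→ℚ c *_) (horner-binomialMonomials k t)))
                   (horner-toMonomials (suc k) cs t) ⟩
    ℕ→ℚ c * ℕ→ℚ (binomial (suc t) k) + ℕ→ℚ (eval₁ (suc k) cs (suc t))
      ≡⟨ cong (_+ ℕ→ℚ (eval₁ (suc k) cs (suc t)))
              (trans (ℚP.*-comm (ℕ→ℚ c) (ℕ→ℚ (binomial (suc t) k))) (sym (ℕ→ℚ-* (binomial (suc t) k) c))) ⟩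
    ℕ→ℚ (binomial (suc t) k ℕ.* c) + ℕ→ℚ (eval₁ (suc k) cs (suc t))
      ≡⟨ sym (ℕ→ℚ-+ (binomial (suc t) k ℕ.* c) (eval₁ (suc k) cs (suc t))) ⟩
    ℕ→ℚ (eval₁ k (c ∷ cs) (suc t)) ∎
    where
    open ≡-Reasoning
    T = ℕ→ℚ t

  coefficient : List ℚ → ℕ → ℚ
  coefficient []       k       = 0ℚ
  coefficient (c ∷ cs) zero    = c
  coefficient (c ∷ cs) (suc k) = coefficient cs k

  sum-coefficients : ∀ d cs x → length cs ℕ.≤ d →
                     sumℚ d (λ k → coefficient cs (toℕ k) * (x ^ℚ toℕ k)) ≡ horner cs x
  sum-coefficients zero    []       x _ = refl
  sum-coefficients (suc d) []       x _ =
    trans (cong (0ℚ * 1ℚ +_) (trans (sum-cong d (λ k → ℚP.*-zeroˡ (x * (x ^ℚ toℕ k)))) (sum-zero d))) refl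
  sum-coefficients (suc d) (c ∷ cs) x (ℕ.s≤s len≤d) = begin
    c * 1ℚ + sumℚ d (λ k → coefficient cs (toℕ k) * (x * (x ^ℚ toℕ k)))
      ≡⟨ cong₂ _+_ (ℚP.*-identityʳ c)
           (sum-cong d (λ k → solve 3 (λ a x p → a :* (x :* p) := x :* (a :* p))
                                      refl (coefficient cs (toℕ k)) x (x ^ℚ toℕ k))) ⟩
    c + sumℚ d (λ k → x * (coefficient cs (toℕ k) * (x ^ℚ toℕ k)))
      ≡⟨ cong (c +_) (trans (sum-*ˡ d x _) (cong (x *_) (sum-coefficients d cs x len≤d))) ⟩
    c + x * horner cs x ∎
    where open ≡-Reasoning

module EhrhartPolynomial where

  open import Defs
  open Lifting using (InDilate-tabulate)
  open CayleyPolytope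
  open LatticePoints
  open CountingPolynomial
  open MonomialBasis
  open import Data.Nat as ℕ using (ℕ; suc)
  open import Data.Rational using (ℚ)
  open import Data.Fin using (toℕ)
  open import Data.Vec using (Vec; tabulate)
  open import Data.List using (List; length)
  open import Data.List.Membership.Propositional using (_∈_)
  open import Data.Product using (Σ; _×_; _,_)
  open import Function using (_∘_; Equivalence)
  open import Relation.Binary.PropositionalEquality
  open Equivalence

  ehrhartCoefficients : ∀ {n} → Vec ℕ n → Vec ℕ n → List ℚ
  ehrhartCoefficients as bs = toMonomials 0 (countingPolynomial as bs)

  latticePoints-complete : ∀ n as bs t x →
    (x ∈ latticePoints n as bs t → InDilate (tabulate (cayley n as bs)) t x) ×
    (InDilate (tabulate (cayley n as bs)) t x → x ∈ latticePoints n as bs t)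
  latticePoints-complete n as bs t x =
    from (InDilate-tabulate (cayley n as bs) t x) ∘ from (InDilate-cayley n as bs t x) ∘
      to (∈-latticePoints n as bs t x) ,
    from (∈-latticePoints n as bs t x) ∘ to (InDilate-cayley n as bs t x) ∘
      to (InDilate-tabulate (cayley n as bs) t x)

  cayley-ehrhart : ∀ n as bs d → length (ehrhartCoefficients as bs) ℕ.≤ suc d → ∀ t →
    Σ ℕ λ k → LatticeCount (tabulate (cayley n as bs)) t k ×
              ℕ→ℚ k ≡ polyEval d (coefficient (ehrhartCoefficients as bs) ∘ toℕ) t
  cayley-ehrhart n as bs d degree≤d t =
    length points , (points , latticePoints-unique n as bs t , latticePoints-complete n as bs t , refl) , count
    where
    open ≡-Reasoning
    points = latticePoints n as bs t
    count : ℕ→ℚ (length points) ≡ polyEval d (coefficient (ehrhartCoefficients as bs) ∘ toℕ) t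
    count = begin
      ℕ→ℚ (length points)
        ≡⟨ cong ℕ→ℚ (trans (length-latticePoints n as bs t) (∑antidiagonal-sliceSize n as bs t)) ⟩
      ℕ→ℚ (eval₁ 0 (countingPolynomial as bs) (suc t))
        ≡⟨ sym (horner-toMonomials 0 (countingPolynomial as bs) t) ⟩
      horner (ehrhartCoefficients as bs) (ℕ→ℚ t)
        ≡⟨ sym (sum-coefficients (suc d) (ehrhartCoefficients as bs) (ℕ→ℚ t) degree≤d) ⟩
      polyEval d (coefficient (ehrhartCoefficients as bs) ∘ toℕ) t ∎

module SignPatterns where

  open import Defs
  open MonomialBasis using (coefficient)
  open EhrhartPolynomial using (ehrhartCoefficients)
  open import Data.Bool using (Bool; true; false)
  open import Data.Nat using (ℕ; suc; _≤_)
  import Data.Nat.Properties as ℕP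
  open import Data.Rational using (ℚ; 0ℚ; _<_; _>_)
  import Data.Rational.Properties as ℚP
  open import Data.Fin using (Fin; zero; suc; toℕ; splitAt)
  import Data.Fin.Properties as Finₚ
  open import Data.Fin.Patterns
  open import Data.Fin.Subset using (Subset; inside; outside)
  open import Data.Fin.Subset.Properties using (anySubset?)
  open import Data.Vec using (Vec; []; _∷_; lookup; tabulate)
  open import Data.Vec.Relation.Unary.All as VecAll using ()
  open import Data.List using (List; length)
  open import Data.List.Relation.Unary.All as All using (All)
  open import Data.List.Membership.DecPropositional ℕP._≟_ using (_∈?_)
  open import Data.Product using (_×_; _,_; proj₁; proj₂)
  open import Data.Sum using (_⊎_; inj₁; inj₂; [_,_]′)
  open import Function using (_∘_; const)
  open import Relation.Nullary using (¬_; Dec; yes; no; does; contradiction; ¬?)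
  open import Relation.Nullary.Decidable using (toWitness; map′; decidable-stable; dec-false; _×-dec_)
  open import Relation.Unary using (Decidable)
  open import Relation.Binary.PropositionalEquality

  allSubsets? : ∀ {n} {P : Subset n → Set} → Decidable P → Dec (∀ p → P p)
  allSubsets? P? = map′ (λ ¬∃¬P p → decidable-stable (P? p) (λ ¬Pp → ¬∃¬P (p , ¬Pp)))
                        (λ ∀P (p , ¬Pp) → ¬Pp (∀P p))
                        (¬? (anySubset? (¬? ∘ P?)))

  -- A sign pattern p : Subset 6 prescribes negative coefficients exactly at tⁱ⁺¹ for i ∈ p.
  negativeAt : Subset 6 → Fin 9 → Bool
  negativeAt p zero    = false
  negativeAt p (suc j) = [ lookup p , const false ]′ (splitAt 6 j)

  HasSign : Bool → ℚ → Set
  HasSign true  q = q < 0ℚ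
  HasSign false q = 0ℚ < q

  hasSign? : ∀ negative q → Dec (HasSign negative q)
  hasSign? true  q = q ℚP.<? 0ℚ
  hasSign? false q = 0ℚ ℚP.<? q

  Realises : Vec ℕ 7 → Vec ℕ 7 → Subset 6 → Set
  Realises as bs p =
    VecAll.All (_≢ 0) as × length (ehrhartCoefficients as bs) ≤ 9 ×
    (∀ j → HasSign (negativeAt p j) (coefficient (ehrhartCoefficients as bs) (toℕ j)))

  realises? : ∀ as bs p → Dec (Realises as bs p)
  realises? as bs p =
    VecAll.all? (λ a → ¬? (a ℕP.≟ 0)) as ×-dec
    length (ehrhartCoefficients as bs) ℕP.≤? 9 ×-dec
    Finₚ.all? (λ j → hasSign? (negativeAt p j) (coefficient (ehrhartCoefficients as bs) (toℕ j)))

  witness : Subset 6 → Vec ℕ 7 × Vec ℕ 7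
  witness (inside  ∷ inside  ∷ inside  ∷ inside  ∷ inside  ∷ inside  ∷ []) =
    (12 ∷ 377 ∷ 336 ∷ 528 ∷ 1073 ∷ 12 ∷ 35 ∷ []) , (1397 ∷ 0 ∷ 894 ∷ 59 ∷ 232 ∷ 254 ∷ 63 ∷ [])
  witness (inside  ∷ inside  ∷ inside  ∷ inside  ∷ inside  ∷ outside ∷ []) =
    (214 ∷ 584 ∷ 870 ∷ 833 ∷ 17 ∷ 55 ∷ 249 ∷ []) , (114 ∷ 504 ∷ 773 ∷ 428 ∷ 584 ∷ 813 ∷ 395 ∷ [])
  witness (inside  ∷ inside  ∷ inside  ∷ inside  ∷ outside ∷ inside  ∷ []) =
    (205 ∷ 1601 ∷ 706 ∷ 766 ∷ 744 ∷ 969 ∷ 674 ∷ []) , (330 ∷ 0 ∷ 751 ∷ 792 ∷ 862 ∷ 525 ∷ 552 ∷ [])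
  witness (inside  ∷ inside  ∷ inside  ∷ inside  ∷ outside ∷ outside ∷ []) =
    (213 ∷ 584 ∷ 947 ∷ 892 ∷ 3 ∷ 12 ∷ 189 ∷ []) , (111 ∷ 504 ∷ 668 ∷ 428 ∷ 1447 ∷ 985 ∷ 459 ∷ [])
  witness (inside  ∷ inside  ∷ inside  ∷ outside ∷ inside  ∷ inside  ∷ []) =
    (295 ∷ 187 ∷ 73 ∷ 797 ∷ 1003 ∷ 474 ∷ 8676 ∷ []) , (279 ∷ 992 ∷ 200 ∷ 732 ∷ 991 ∷ 571 ∷ 25 ∷ [])
  witness (inside  ∷ inside  ∷ inside  ∷ outside ∷ inside  ∷ outside ∷ []) =
    (138 ∷ 584 ∷ 870 ∷ 1005 ∷ 11 ∷ 62 ∷ 257 ∷ []) , (120 ∷ 507 ∷ 773 ∷ 423 ∷ 1195 ∷ 375 ∷ 385 ∷ [])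
  witness (inside  ∷ inside  ∷ inside  ∷ outside ∷ outside ∷ inside  ∷ []) =
    (492 ∷ 15 ∷ 904 ∷ 201 ∷ 3666 ∷ 1210 ∷ 1212 ∷ []) , (373 ∷ 161 ∷ 56 ∷ 0 ∷ 178 ∷ 123 ∷ 292 ∷ [])
  witness (inside  ∷ inside  ∷ inside  ∷ outside ∷ outside ∷ outside ∷ []) =
    (141 ∷ 583 ∷ 870 ∷ 833 ∷ 12 ∷ 55 ∷ 257 ∷ []) , (120 ∷ 504 ∷ 776 ∷ 423 ∷ 843 ∷ 375 ∷ 381 ∷ [])
  witness (inside  ∷ inside  ∷ outside ∷ inside  ∷ inside  ∷ inside  ∷ []) =
    (117 ∷ 1296 ∷ 824 ∷ 298 ∷ 535 ∷ 62 ∷ 2096 ∷ []) , (143 ∷ 238 ∷ 560 ∷ 1111 ∷ 599 ∷ 69 ∷ 0 ∷ [])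
  witness (inside  ∷ inside  ∷ outside ∷ inside  ∷ inside  ∷ outside ∷ []) =
    (516 ∷ 909 ∷ 848 ∷ 320 ∷ 180 ∷ 592 ∷ 550 ∷ []) , (522 ∷ 741 ∷ 983 ∷ 395 ∷ 152 ∷ 1480 ∷ 538 ∷ [])
  witness (inside  ∷ inside  ∷ outside ∷ inside  ∷ outside ∷ inside  ∷ []) =
    (2764 ∷ 145 ∷ 842 ∷ 456 ∷ 1090 ∷ 421 ∷ 1012 ∷ []) , (19 ∷ 318 ∷ 960 ∷ 588 ∷ 550 ∷ 571 ∷ 318 ∷ [])
  witness (inside  ∷ inside  ∷ outside ∷ inside  ∷ outside ∷ outside ∷ []) =
    (204 ∷ 580 ∷ 862 ∷ 819 ∷ 36 ∷ 64 ∷ 255 ∷ []) , (123 ∷ 511 ∷ 779 ∷ 498 ∷ 712 ∷ 739 ∷ 439 ∷ [])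
  witness (inside  ∷ inside  ∷ outside ∷ outside ∷ inside  ∷ inside  ∷ []) =
    (65 ∷ 43 ∷ 25 ∷ 25 ∷ 64 ∷ 70 ∷ 8676 ∷ []) , (1799 ∷ 992 ∷ 73 ∷ 1976 ∷ 1300 ∷ 1126 ∷ 25 ∷ [])
  witness (inside  ∷ inside  ∷ outside ∷ outside ∷ inside  ∷ outside ∷ []) =
    (147 ∷ 584 ∷ 870 ∷ 1002 ∷ 11 ∷ 55 ∷ 249 ∷ []) , (111 ∷ 504 ∷ 773 ∷ 423 ∷ 1313 ∷ 375 ∷ 459 ∷ [])
  witness (inside  ∷ inside  ∷ outside ∷ outside ∷ outside ∷ inside  ∷ []) =
    (632 ∷ 50 ∷ 1898 ∷ 2789 ∷ 712 ∷ 1149 ∷ 2093 ∷ []) , (63 ∷ 1050 ∷ 194 ∷ 341 ∷ 48 ∷ 54 ∷ 920 ∷ [])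
  witness (inside  ∷ inside  ∷ outside ∷ outside ∷ outside ∷ outside ∷ []) =
    (105 ∷ 504 ∷ 668 ∷ 428 ∷ 1447 ∷ 985 ∷ 2096 ∷ []) , (184 ∷ 784 ∷ 957 ∷ 1005 ∷ 0 ∷ 12 ∷ 0 ∷ [])
  witness (inside  ∷ outside ∷ inside  ∷ inside  ∷ inside  ∷ inside  ∷ []) =
    (30 ∷ 12 ∷ 100 ∷ 766 ∷ 2645 ∷ 1940 ∷ 21 ∷ []) , (995 ∷ 4735 ∷ 992 ∷ 709 ∷ 48 ∷ 23 ∷ 24 ∷ [])
  witness (inside  ∷ outside ∷ inside  ∷ inside  ∷ inside  ∷ outside ∷ []) =
    (370 ∷ 728 ∷ 330 ∷ 379 ∷ 244 ∷ 969 ∷ 266 ∷ []) , (411 ∷ 181 ∷ 118 ∷ 547 ∷ 277 ∷ 967 ∷ 267 ∷ [])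
  witness (inside  ∷ outside ∷ inside  ∷ inside  ∷ outside ∷ inside  ∷ []) =
    (895 ∷ 632 ∷ 588 ∷ 50 ∷ 695 ∷ 877 ∷ 713 ∷ []) , (48 ∷ 6 ∷ 676 ∷ 255 ∷ 662 ∷ 914 ∷ 648 ∷ [])
  witness (inside  ∷ outside ∷ inside  ∷ inside  ∷ outside ∷ outside ∷ []) =
    (153 ∷ 580 ∷ 1151 ∷ 511 ∷ 36 ∷ 55 ∷ 305 ∷ []) , (145 ∷ 585 ∷ 779 ∷ 505 ∷ 1313 ∷ 985 ∷ 203 ∷ [])
  witness (inside  ∷ outside ∷ inside  ∷ outside ∷ inside  ∷ inside  ∷ []) =
    (147 ∷ 584 ∷ 562 ∷ 1671 ∷ 601 ∷ 12 ∷ 35 ∷ []) , (170 ∷ 504 ∷ 824 ∷ 56 ∷ 470 ∷ 140 ∷ 1299 ∷ [])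
  witness (inside  ∷ outside ∷ inside  ∷ outside ∷ inside  ∷ outside ∷ []) =
    (138 ∷ 580 ∷ 867 ∷ 886 ∷ 39 ∷ 112 ∷ 285 ∷ []) , (148 ∷ 518 ∷ 787 ∷ 525 ∷ 285 ∷ 197 ∷ 371 ∷ [])
  witness (inside  ∷ outside ∷ inside  ∷ outside ∷ outside ∷ inside  ∷ []) =
    (1342 ∷ 908 ∷ 322 ∷ 799 ∷ 614 ∷ 333 ∷ 3 ∷ []) , (576 ∷ 31 ∷ 34 ∷ 354 ∷ 673 ∷ 293 ∷ 35 ∷ [])
  witness (inside  ∷ outside ∷ inside  ∷ outside ∷ outside ∷ outside ∷ []) =
    (618 ∷ 681 ∷ 463 ∷ 896 ∷ 843 ∷ 796 ∷ 822 ∷ []) , (507 ∷ 638 ∷ 335 ∷ 1017 ∷ 933 ∷ 530 ∷ 926 ∷ [])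
  witness (inside  ∷ outside ∷ outside ∷ inside  ∷ inside  ∷ inside  ∷ []) =
    (946 ∷ 917 ∷ 1032 ∷ 186 ∷ 18 ∷ 1090 ∷ 750 ∷ []) , (518 ∷ 592 ∷ 377 ∷ 388 ∷ 158 ∷ 759 ∷ 14 ∷ [])
  witness (inside  ∷ outside ∷ outside ∷ inside  ∷ inside  ∷ outside ∷ []) =
    (212 ∷ 17 ∷ 760 ∷ 541 ∷ 638 ∷ 370 ∷ 803 ∷ []) , (144 ∷ 10 ∷ 814 ∷ 565 ∷ 871 ∷ 665 ∷ 905 ∷ [])
  witness (inside  ∷ outside ∷ outside ∷ inside  ∷ outside ∷ inside  ∷ []) =
    (63 ∷ 5 ∷ 315 ∷ 5 ∷ 9 ∷ 1 ∷ 590 ∷ []) , (2172 ∷ 12034 ∷ 51 ∷ 2444 ∷ 1404 ∷ 1817 ∷ 146 ∷ [])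
  witness (inside  ∷ outside ∷ outside ∷ inside  ∷ outside ∷ outside ∷ []) =
    (436 ∷ 888 ∷ 458 ∷ 925 ∷ 1480 ∷ 174 ∷ 417 ∷ []) , (102 ∷ 56 ∷ 565 ∷ 838 ∷ 52 ∷ 54 ∷ 473 ∷ [])
  witness (inside  ∷ outside ∷ outside ∷ outside ∷ inside  ∷ inside  ∷ []) =
    (159 ∷ 504 ∷ 990 ∷ 56 ∷ 470 ∷ 254 ∷ 203 ∷ []) , (143 ∷ 584 ∷ 48 ∷ 1671 ∷ 601 ∷ 12 ∷ 0 ∷ [])
  witness (inside  ∷ outside ∷ outside ∷ outside ∷ inside  ∷ outside ∷ []) =
    (144 ∷ 584 ∷ 947 ∷ 1002 ∷ 12 ∷ 55 ∷ 240 ∷ []) , (163 ∷ 508 ∷ 773 ∷ 423 ∷ 428 ∷ 319 ∷ 450 ∷ [])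
  witness (inside  ∷ outside ∷ outside ∷ outside ∷ outside ∷ inside  ∷ []) =
    (1228 ∷ 1034 ∷ 1357 ∷ 614 ∷ 242 ∷ 1155 ∷ 102 ∷ []) , (273 ∷ 231 ∷ 697 ∷ 280 ∷ 296 ∷ 497 ∷ 546 ∷ [])
  witness (inside  ∷ outside ∷ outside ∷ outside ∷ outside ∷ outside ∷ []) =
    (205 ∷ 582 ∷ 569 ∷ 821 ∷ 23 ∷ 63 ∷ 342 ∷ []) , (176 ∷ 657 ∷ 535 ∷ 1004 ∷ 659 ∷ 739 ∷ 385 ∷ [])
  witness (outside ∷ inside  ∷ inside  ∷ inside  ∷ inside  ∷ inside  ∷ []) =
    (56 ∷ 978 ∷ 122 ∷ 51 ∷ 179 ∷ 72 ∷ 1 ∷ []) , (910 ∷ 197 ∷ 3256 ∷ 8 ∷ 1066 ∷ 0 ∷ 1573 ∷ [])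
  witness (outside ∷ inside  ∷ inside  ∷ inside  ∷ inside  ∷ outside ∷ []) =
    (221 ∷ 217 ∷ 703 ∷ 635 ∷ 738 ∷ 53 ∷ 663 ∷ []) , (337 ∷ 0 ∷ 755 ∷ 793 ∷ 861 ∷ 21 ∷ 616 ∷ [])
  witness (outside ∷ inside  ∷ inside  ∷ inside  ∷ outside ∷ inside  ∷ []) =
    (965 ∷ 121 ∷ 486 ∷ 1462 ∷ 994 ∷ 3 ∷ 633 ∷ []) , (914 ∷ 185 ∷ 887 ∷ 81 ∷ 19 ∷ 35 ∷ 518 ∷ [])
  witness (outside ∷ inside  ∷ inside  ∷ inside  ∷ outside ∷ outside ∷ []) =
    (922 ∷ 122 ∷ 399 ∷ 841 ∷ 1269 ∷ 840 ∷ 693 ∷ []) , (69 ∷ 123 ∷ 359 ∷ 823 ∷ 106 ∷ 292 ∷ 680 ∷ [])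
  witness (outside ∷ inside  ∷ inside  ∷ outside ∷ inside  ∷ inside  ∷ []) =
    (289 ∷ 246 ∷ 83 ∷ 797 ∷ 992 ∷ 484 ∷ 1680 ∷ []) , (287 ∷ 341 ∷ 119 ∷ 746 ∷ 998 ∷ 556 ∷ 123 ∷ [])
  witness (outside ∷ inside  ∷ inside  ∷ outside ∷ inside  ∷ outside ∷ []) =
    (2 ∷ 12 ∷ 8 ∷ 458 ∷ 37 ∷ 22 ∷ 344 ∷ []) , (65 ∷ 2234 ∷ 78 ∷ 53 ∷ 0 ∷ 2472 ∷ 0 ∷ [])
  witness (outside ∷ inside  ∷ inside  ∷ outside ∷ outside ∷ inside  ∷ []) =
    (252 ∷ 485 ∷ 488 ∷ 95 ∷ 13 ∷ 240 ∷ 511 ∷ []) , (1102 ∷ 1966 ∷ 897 ∷ 1132 ∷ 0 ∷ 870 ∷ 830 ∷ [])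
  witness (outside ∷ inside  ∷ inside  ∷ outside ∷ outside ∷ outside ∷ []) =
    (546 ∷ 341 ∷ 799 ∷ 50 ∷ 753 ∷ 575 ∷ 672 ∷ []) , (603 ∷ 348 ∷ 788 ∷ 36 ∷ 704 ∷ 568 ∷ 678 ∷ [])
  witness (outside ∷ inside  ∷ outside ∷ inside  ∷ inside  ∷ inside  ∷ []) =
    (377 ∷ 136 ∷ 77 ∷ 919 ∷ 1162 ∷ 486 ∷ 5863 ∷ []) , (272 ∷ 992 ∷ 119 ∷ 284 ∷ 939 ∷ 571 ∷ 25 ∷ [])
  witness (outside ∷ inside  ∷ outside ∷ inside  ∷ inside  ∷ outside ∷ []) =
    (93 ∷ 1065 ∷ 867 ∷ 194 ∷ 328 ∷ 840 ∷ 687 ∷ []) , (105 ∷ 702 ∷ 860 ∷ 279 ∷ 261 ∷ 848 ∷ 539 ∷ [])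
  witness (outside ∷ inside  ∷ outside ∷ inside  ∷ outside ∷ inside  ∷ []) =
    (2073 ∷ 434 ∷ 1039 ∷ 746 ∷ 23 ∷ 513 ∷ 327 ∷ []) , (521 ∷ 871 ∷ 986 ∷ 288 ∷ 42 ∷ 716 ∷ 45 ∷ [])
  witness (outside ∷ inside  ∷ outside ∷ inside  ∷ outside ∷ outside ∷ []) =
    (325 ∷ 359 ∷ 34 ∷ 238 ∷ 146 ∷ 2263 ∷ 3144 ∷ []) , (298 ∷ 315 ∷ 96 ∷ 279 ∷ 159 ∷ 0 ∷ 3 ∷ [])
  witness (outside ∷ inside  ∷ outside ∷ outside ∷ inside  ∷ inside  ∷ []) =
    (53 ∷ 43 ∷ 27 ∷ 818 ∷ 64 ∷ 70 ∷ 8676 ∷ []) , (1799 ∷ 992 ∷ 31 ∷ 746 ∷ 1300 ∷ 1126 ∷ 25 ∷ [])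
  witness (outside ∷ inside  ∷ outside ∷ outside ∷ inside  ∷ outside ∷ []) =
    (30 ∷ 190 ∷ 42 ∷ 1012 ∷ 806 ∷ 347 ∷ 962 ∷ []) , (284 ∷ 547 ∷ 55 ∷ 933 ∷ 1067 ∷ 964 ∷ 309 ∷ [])
  witness (outside ∷ inside  ∷ outside ∷ outside ∷ outside ∷ inside  ∷ []) =
    (371 ∷ 688 ∷ 689 ∷ 419 ∷ 336 ∷ 853 ∷ 146 ∷ []) , (293 ∷ 282 ∷ 90 ∷ 323 ∷ 300 ∷ 882 ∷ 366 ∷ [])
  witness (outside ∷ inside  ∷ outside ∷ outside ∷ outside ∷ outside ∷ []) =
    (15 ∷ 43 ∷ 33 ∷ 1072 ∷ 64 ∷ 70 ∷ 1421 ∷ []) , (108 ∷ 1600 ∷ 103 ∷ 933 ∷ 2211 ∷ 1554 ∷ 309 ∷ [])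
  witness (outside ∷ outside ∷ inside  ∷ inside  ∷ inside  ∷ inside  ∷ []) =
    (123 ∷ 764 ∷ 1042 ∷ 1285 ∷ 914 ∷ 15 ∷ 4 ∷ []) , (50 ∷ 2 ∷ 9 ∷ 59 ∷ 186 ∷ 813 ∷ 1776 ∷ [])
  witness (outside ∷ outside ∷ inside  ∷ inside  ∷ inside  ∷ outside ∷ []) =
    (204 ∷ 580 ∷ 763 ∷ 818 ∷ 61 ∷ 132 ∷ 338 ∷ []) , (172 ∷ 586 ∷ 788 ∷ 506 ∷ 206 ∷ 273 ∷ 371 ∷ [])
  witness (outside ∷ outside ∷ inside  ∷ inside  ∷ outside ∷ inside  ∷ []) =
    (191 ∷ 349 ∷ 299 ∷ 716 ∷ 26 ∷ 927 ∷ 615 ∷ []) , (233 ∷ 159 ∷ 346 ∷ 746 ∷ 2576 ∷ 619 ∷ 1902 ∷ [])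
  witness (outside ∷ outside ∷ inside  ∷ inside  ∷ outside ∷ outside ∷ []) =
    (211 ∷ 584 ∷ 866 ∷ 645 ∷ 12 ∷ 12 ∷ 338 ∷ []) , (136 ∷ 504 ∷ 773 ∷ 423 ∷ 1313 ∷ 985 ∷ 245 ∷ [])
  witness (outside ∷ outside ∷ inside  ∷ outside ∷ inside  ∷ inside  ∷ []) =
    (25 ∷ 136 ∷ 33 ∷ 1072 ∷ 812 ∷ 371 ∷ 8716 ∷ []) , (513 ∷ 548 ∷ 87 ∷ 478 ∷ 1063 ∷ 1041 ∷ 25 ∷ [])
  witness (outside ∷ outside ∷ inside  ∷ outside ∷ inside  ∷ outside ∷ []) =
    (514 ∷ 660 ∷ 126 ∷ 204 ∷ 705 ∷ 232 ∷ 877 ∷ []) , (883 ∷ 1043 ∷ 56 ∷ 158 ∷ 414 ∷ 9 ∷ 869 ∷ [])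
  witness (outside ∷ outside ∷ inside  ∷ outside ∷ outside ∷ inside  ∷ []) =
    (1 ∷ 559 ∷ 7 ∷ 803 ∷ 5 ∷ 12 ∷ 5 ∷ []) , (2096 ∷ 415 ∷ 0 ∷ 645 ∷ 1572 ∷ 1667 ∷ 1359 ∷ [])
  witness (outside ∷ outside ∷ inside  ∷ outside ∷ outside ∷ outside ∷ []) =
    (593 ∷ 514 ∷ 134 ∷ 369 ∷ 398 ∷ 810 ∷ 124 ∷ []) , (596 ∷ 472 ∷ 121 ∷ 375 ∷ 425 ∷ 833 ∷ 127 ∷ [])
  witness (outside ∷ outside ∷ outside ∷ inside  ∷ inside  ∷ inside  ∷ []) =
    (67 ∷ 1339 ∷ 800 ∷ 379 ∷ 673 ∷ 22 ∷ 732 ∷ []) , (646 ∷ 72 ∷ 78 ∷ 65 ∷ 0 ∷ 540 ∷ 3 ∷ [])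
  witness (outside ∷ outside ∷ outside ∷ inside  ∷ inside  ∷ outside ∷ []) =
    (206 ∷ 573 ∷ 756 ∷ 820 ∷ 41 ∷ 89 ∷ 335 ∷ []) , (168 ∷ 590 ∷ 793 ∷ 500 ∷ 236 ∷ 274 ∷ 373 ∷ [])
  witness (outside ∷ outside ∷ outside ∷ inside  ∷ outside ∷ inside  ∷ []) =
    (164 ∷ 5 ∷ 356 ∷ 102 ∷ 22 ∷ 1 ∷ 656 ∷ []) , (860 ∷ 1373 ∷ 61 ∷ 525 ∷ 1052 ∷ 871 ∷ 167 ∷ [])
  witness (outside ∷ outside ∷ outside ∷ inside  ∷ outside ∷ outside ∷ []) =
    (166 ∷ 576 ∷ 858 ∷ 510 ∷ 100 ∷ 383 ∷ 338 ∷ []) , (148 ∷ 523 ∷ 793 ∷ 527 ∷ 127 ∷ 413 ∷ 265 ∷ [])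
  witness (outside ∷ outside ∷ outside ∷ outside ∷ inside  ∷ inside  ∷ []) =
    (24 ∷ 53 ∷ 23 ∷ 1461 ∷ 227 ∷ 346 ∷ 906 ∷ []) , (159 ∷ 966 ∷ 480 ∷ 386 ∷ 2211 ∷ 1297 ∷ 248 ∷ [])
  witness (outside ∷ outside ∷ outside ∷ outside ∷ inside  ∷ outside ∷ []) =
    (134 ∷ 582 ∷ 759 ∷ 997 ∷ 22 ∷ 109 ∷ 279 ∷ []) , (210 ∷ 508 ∷ 793 ∷ 423 ∷ 1313 ∷ 274 ∷ 381 ∷ [])
  witness (outside ∷ outside ∷ outside ∷ outside ∷ outside ∷ inside  ∷ []) =
    (948 ∷ 173 ∷ 2877 ∷ 711 ∷ 146 ∷ 225 ∷ 893 ∷ []) , (63 ∷ 839 ∷ 87 ∷ 1288 ∷ 52 ∷ 23 ∷ 24 ∷ [])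
  witness (outside ∷ outside ∷ outside ∷ outside ∷ outside ∷ outside ∷ []) =
    (1 ∷ 1 ∷ 1 ∷ 1 ∷ 1 ∷ 1 ∷ 1 ∷ []) , (1 ∷ 1 ∷ 1 ∷ 1 ∷ 1 ∷ 1 ∷ 1 ∷ [])

  witness-realises : ∀ p → Realises (proj₁ (witness p)) (proj₂ (witness p)) p
  witness-realises = toWitness {a? = allSubsets? (λ p → realises? (proj₁ (witness p)) (proj₂ (witness p)) p)} _

  signPattern : List ℕ → Subset 6
  signPattern is = tabulate (λ i → does (suc (toℕ i) ∈? is))

  module _ {is : List ℕ} (bounds : All (λ i → 1 ≤ i × i ≤ 6) is) where

    private
      outside-bounds : ∀ k → k ≡ 0 ⊎ 7 ≤ k → does (k ∈? is) ≡ false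
      outside-bounds k k∉[1,6] = dec-false (k ∈? is) (out-of-range k∉[1,6] ∘ All.lookup bounds)
        where
        out-of-range : k ≡ 0 ⊎ 7 ≤ k → ¬ (1 ≤ k × k ≤ 6)
        out-of-range (inj₁ refl) (1≤0 , _) = ℕP.<-irrefl refl 1≤0
        out-of-range (inj₂ 7≤k)  (_ , k≤6) = ℕP.<-irrefl refl (ℕP.≤-trans 7≤k k≤6)

    negativeAt-signPattern : ∀ j → negativeAt (signPattern is) j ≡ does (toℕ j ∈? is)
    negativeAt-signPattern 0F = sym (outside-bounds 0 (inj₁ refl))
    negativeAt-signPattern 1F = refl
    negativeAt-signPattern 2F = refl
    negativeAt-signPattern 3F = refl
    negativeAt-signPattern 4F = refl
    negativeAt-signPattern 5F = refl
    negativeAt-signPattern 6F = refl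
    negativeAt-signPattern 7F = sym (outside-bounds 7 (inj₂ ℕP.≤-refl))
    negativeAt-signPattern 8F = sym (outside-bounds 8 (inj₂ (ℕP.n≤1+n 7)))

  hasSign-dec : ∀ {P : Set} (P? : Dec P) {q} → HasSign (does P?) q → (P → q < 0ℚ) × (¬ P → q > 0ℚ)
  hasSign-dec (yes p) q<0 = (λ _ → q<0) , (λ ¬p → contradiction p ¬p)
  hasSign-dec (no ¬p) q>0 = (λ p → contradiction p ¬p) , (λ _ → q>0)

open import Defs
open import Data.Nat using (ℕ; suc; _≤_; _≥_; _≟_)
open import Data.Integer using (ℤ)
open import Data.Rational using (ℚ; 0ℚ; _<_; _>_)
open import Data.Fin using (Fin; toℕ)
open import Data.Vec using (Vec; tabulate)
open import Data.List using (List; length)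
open import Data.List.Relation.Unary.All using (All)
open import Data.List.Membership.Propositional using (_∈_)
open import Data.Product using (Σ; _×_; _,_)
open import Function using (_∘_)
open import Relation.Nullary using (¬_)
open import Relation.Binary.PropositionalEquality using (_≡_; subst)
open CayleyPolytope using (cayley; lastVertex)
open CayleyDimension using (cayley-dimension)
open MonomialBasis using (coefficient)
open EhrhartPolynomial using (ehrhartCoefficients; cayley-ehrhart)
open import Data.List.Membership.DecPropositional _≟_ using (_∈?_)
open SignPatterns

-- Only membership in is matters, so is need not be nonempty or increasing; and the lattice-point
-- count is valid for every t, including t = 0.
theorem6p7 : (is : List ℕ) → length is ≥ 1 → Increasing is →
    All (λ i → 1 ≤ i × i ≤ 6) is →
    Σ ℕ λ N → Σ ℕ λ k → Σ (Vec (Point N) (suc k)) λ V →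
    HasDimension V 8 ×
    Σ (Fin 9 → ℚ) λ c →
    ((t : ℕ) → t ≥ 1 → Σ ℕ λ n → LatticeCount V t n × ℕ→ℚ n ≡ polyEval 8 c t) ×
    ((j : Fin 9) → (toℕ j ∈ is → c j < 0ℚ) × (¬ (toℕ j ∈ is) → c j > 0ℚ))
theorem6p7 is _ _ bounds =
  let p = signPattern is
      as , bs = witness p
      as≢0 , degree≤8 , signs = witness-realises p
      c = coefficient (ehrhartCoefficients as bs) ∘ toℕ
  in 8 , lastVertex 7 , tabulate (cayley 7 as bs) , cayley-dimension 7 as bs as≢0 , c ,
     (λ t _ → cayley-ehrhart 7 as bs 8 degree≤8 t) ,
     λ j → hasSign-dec (toℕ j ∈? is)
             (subst (λ negative → HasSign negative (c j)) (negativeAt-signPattern bounds j) (signs j))
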